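{- Let $n\ge1$ and $g\in S_{2n}$. Then $D^g$ is a path for all $D\in\mathcal{D}_n$ if and only if $g\in G$, where $G\le S_{2n}$ is the dihedral group generated by $\rho$ and $\omega$.
   Context: A Dyck path of size $n$ is a word in $\mathtt{u},\mathtt{d}$ with $n$ of each letter whose every prefix has at least as many $\mathtt{u}$'s as $\mathtt{d}$'s; $\mathcal{D}_n$ is their set. The tunneling $\tau_D\in S_{2n}$ of $D$ is the fixed-point-free involution pairing each up-step position with the position of its matching down-step. For $g\in S_{2n}$, $D^g$ denotes the pairing of $[2n]$ with tunneling $\tau_{D^g}$ given by $\tau_{D^g}(g(k))=g(\tau_D(k))$ for all $k$ (the chord diagram of $D$ with labels permuted by $g$); $D^g$ is a path if $\tau_{D^g}=\tau_P$ for some $P\in\mathcal{D}_n$. The permutations $\rho,\omega\in S_{2n}$ are $\rho(k)=k+1$ and $\omega(k)=2n-k$, with arithmetic modulo $2n$ and values taken in $[2n]$ (rotation and reflection of the $2n$ labels on a circle); $G=\langle\rho,\omega\rangle$. -}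

module Defs where

open import Data.Nat using (ℕ; zero; suc; _+_; _*_; _∸_; _≤_; _<_; s≤s; z≤n; NonZero; _≤?_; _<?_)
open import Data.Nat.DivMod using (_%_; m%n<n)
open import Data.Fin using (Fin; toℕ; fromℕ<)
open import Data.List using (List; []; _∷_; length; filter; allFin)
open import Data.Product using (Σ; _×_; ∃)
open import Data.Sum using (_⊎_)
open import Relation.Nullary using (Dec; yes; no)
open import Relation.Nullary.Decidable using (_×-dec_)
open import Relation.Binary.PropositionalEquality using (_≡_; refl)
open import Function.Bundles using (_⇔_)
open import Data.Fin.Permutation using (Permutation′; _⟨$⟩ʳ_)

-- Steps and Dyck paths.  Positions 1..2n of the paper are represented
-- by Fin (2 * n) = {0,…,2n-1} (label k ↔ index k-1).

data Step : Set where
  u d : Step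

_≟ₛ_ : (s t : Step) → Dec (s ≡ t)
u ≟ₛ u = yes refl
u ≟ₛ d = no (λ ())
d ≟ₛ u = no (λ ())
d ≟ₛ d = yes refl

Word : ℕ → Set
Word m = Fin m → Step

cnt : {m : ℕ} → Step → Word m → ℕ → ℕ → ℕ
cnt {m} s D a b =
  length (filter (λ p → (a ≤? toℕ p) ×-dec ((toℕ p <? b) ×-dec (D p ≟ₛ s))) (allFin m))

IsDyck : (n : ℕ) → Word (2 * n) → Set
IsDyck n D =
  cnt u D 0 (2 * n) ≡ n × cnt d D 0 (2 * n) ≡ n ×
  (∀ k → k ≤ 2 * n → cnt d D 0 k ≤ cnt u D 0 k)

Match : {m : ℕ} → Word m → Fin m → Fin m → Set
Match D i j =
  toℕ i < toℕ j × D i ≡ u × D j ≡ d ×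
  cnt u D (toℕ i) (suc (toℕ j)) ≡ cnt d D (toℕ i) (suc (toℕ j)) ×
  (∀ k → toℕ i < k → k ≤ toℕ j → cnt d D (toℕ i) k < cnt u D (toℕ i) k)

-- Graph of the tunneling involution τ_D: a and b are paired (τ_D a = b).
Paired : {m : ℕ} → Word m → Fin m → Fin m → Set
Paired D a b = Match D a b ⊎ Match D b a

-- D^g is a path: there is a Dyck path P whose tunneling τ_P equals the
-- pairing of D^g, i.e. τ_P (g a) = g (τ_D a) for all a; equivalently
-- P pairs g a with g b exactly when D pairs a with b.
IsPathAfter : (n : ℕ) → Word (2 * n) → (Fin (2 * n) → Fin (2 * n)) → Set
IsPathAfter n D g =
  Σ (Word (2 * n)) λ P → IsDyck n P × (∀ a b → Paired P (g a) (g b) ⇔ Paired D a b)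

-- Paper: ρ(k) = k+1, ω(k) = 2n-k (mod 2n, values in [2n]).
-- With index i = k-1 (N = 2n):  ρ(i) = i+1 mod N,
-- ω(i) = (2n - (i+1)) - 1 mod N = (2N - 2 - i) mod N.

nz2 : {n : ℕ} → 1 ≤ n → NonZero (2 * n)
nz2 {suc n} (s≤s _) = _

modFin : (N : ℕ) → .{{NonZero N}} → ℕ → Fin N
modFin N x = fromℕ< (m%n<n x N)

rotate : (N : ℕ) → .{{NonZero N}} → Fin N → Fin N
rotate N i = modFin N (suc (toℕ i))

rotate⁻¹ : (N : ℕ) → .{{NonZero N}} → Fin N → Fin N
rotate⁻¹ N i = modFin N (toℕ i + (N ∸ 1))

reflect : (N : ℕ) → .{{NonZero N}} → Fin N → Fin N
reflect N i = modFin N ((2 * N ∸ 2) ∸ toℕ i)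

data Gen : Set where
  ρ ρ⁻¹ ω ω⁻¹ : Gen

evalGen : (N : ℕ) → .{{NonZero N}} → Gen → Fin N → Fin N
evalGen N ρ   = rotate N
evalGen N ρ⁻¹ = rotate⁻¹ N
evalGen N ω   = reflect N
evalGen N ω⁻¹ = reflect N

evalWord : (N : ℕ) → .{{NonZero N}} → List Gen → Fin N → Fin N
evalWord N []       i = i
evalWord N (x ∷ xs) i = evalGen N x (evalWord N xs i)

InDihedral : (n : ℕ) → 1 ≤ n → Permutation′ (2 * n) → Set
InDihedral n h g =
  ∃ λ (w : List Gen) → ∀ i → g ⟨$⟩ʳ i ≡ evalWord (2 * n) {{nz2 h}} w i

-- D^g is a path iff the chord diagram of D relabelled by g is again noncrossing, because the
-- noncrossing perfect matchings of the 2n positions are exactly the tunnelings of Dyck paths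
-- (every such matching has a chord between neighbours; removing it and inducting gives the path).
-- Rotation and reflection preserve noncrossing, so every g ∈ G maps paths to paths.
-- Conversely, if g does, then g j and g (j+1) are neighbours on the circle: rotating reduces to
-- j = 0, and for each k ≥ 2 some Dyck path has both chords (0,1) and (k,k+1), so the chord
-- {g 0, g 1} never separates g k from g (k+1) and all other points lie on one side of it.
-- A bijection of the cycle that maps neighbours to neighbours is a rotation or a reflected one.
module Submission where

open import Defs
open import Data.Bool using (Bool; true; false)
open import Data.Bool.Properties using (∧-zeroʳ)
open import Data.Nat
open import Data.Nat.Properties
open import Data.Nat.DivMod
open import Data.Nat.Tactic.RingSolver using (solve-∀)
open import Data.Fin using (Fin; toℕ; fromℕ<)
open import Data.Fin.Properties using (toℕ<n; toℕ-fromℕ<; toℕ-injective)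
open import Data.Fin.Permutation using (Permutation′; _⟨$⟩ʳ_; _⟨$⟩ˡ_; inverseˡ; inverseʳ)
open import Data.List using ([]; _∷_; [_]; _++_; length; filter; tabulate; applyUpTo; upTo; replicate)
open import Data.List.Properties using (upTo-∷ʳ; filter-++; length-++)
open import Data.Product using (∃; _×_; _,_; proj₁; proj₂)
open import Data.Sum using (_⊎_; inj₁; inj₂)
import Data.Sum as ⊎
open import Data.Empty using (⊥; ⊥-elim)
open import Relation.Nullary using (Dec; yes; no; does; ¬_)
open import Relation.Nullary.Decidable using (_×-dec_; dec-true; dec-false)
open import Relation.Unary using (Pred; Decidable)
open import Relation.Binary.Definitions using (tri<; tri≈; tri>)
open import Relation.Binary.PropositionalEquality
  using (_≡_; _≢_; refl; sym; trans; cong; cong₂; subst; subst₂; module ≡-Reasoning)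
import Relation.Binary.Reasoning.Setoid as SetoidReasoning
open import Level using (0ℓ)
open import Function using (_∘_; id)
open import Function.Bundles using (_⇔_; mk⇔; Equivalence)
import Function.Properties.Equivalence as ⇔

-- Words extended to all of ℕ, so that positions need no bound proofs.
Wordℕ : Set
Wordℕ = ℕ → Step

indicator : Bool → ℕ
indicator true  = 1
indicator false = 0

count : Step → Wordℕ → ℕ → ℕ → ℕ
count s w a zero    = 0
count s w a (suc b) = count s w a b + indicator (does ((a ≤? b) ×-dec (w b ≟ₛ s)))

count-empty : ∀ s w {a b} → b ≤ a → count s w a b ≡ 0
count-empty s w {a} {zero}  _   = refl
count-empty s w {a} {suc b} b<a
  rewrite dec-false (a ≤? b) (<⇒≱ b<a) | count-empty s w (<⇒≤ b<a) = refl

count-snoc : ∀ s w {a b} → a ≤ b → count s w a (suc b) ≡ count s w a b + indicator (does (w b ≟ₛ s))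
count-snoc s w {a} {b} a≤b rewrite dec-true (a ≤? b) a≤b = refl

count-split : ∀ s w {a b c} → a ≤ b → b ≤ c → count s w a c ≡ count s w a b + count s w b c
count-split s w {a} {b} {c} a≤b b≤c with m≤n⇒m<n∨m≡n b≤c
... | inj₂ refl = sym (trans (cong (count s w a b +_) (count-empty s w (≤-refl {b}))) (+-identityʳ _))
count-split s w {a} {b} {suc c} a≤b _ | inj₁ (s≤s b≤c) = begin
  count s w a (suc c)                 ≡⟨ count-snoc s w (≤-trans a≤b b≤c) ⟩
  count s w a c + x                   ≡⟨ cong (_+ x) (count-split s w a≤b b≤c) ⟩
  count s w a b + count s w b c + x   ≡⟨ +-assoc (count s w a b) _ x ⟩
  count s w a b + (count s w b c + x) ≡⟨ cong (count s w a b +_) (count-snoc s w b≤c) ⟨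
  count s w a b + count s w b (suc c) ∎
  where
  open ≡-Reasoning
  x : ℕ
  x = indicator (does (w c ≟ₛ s))

count-cong : ∀ s {v w a b} → (∀ k → a ≤ k → k < b → v k ≡ w k) → count s v a b ≡ count s w a b
count-cong s {b = zero}          _  = refl
count-cong s {v} {w} {a} {suc b} eq with a ≤? b
... | yes a≤b rewrite count-snoc s v a≤b | count-snoc s w a≤b | eq b a≤b ≤-refl
  = cong (_+ _) (count-cong s (λ k a≤k k<b → eq k a≤k (m<n⇒m<1+n k<b)))
... | no a≰b rewrite count-empty s v (≰⇒> a≰b) | count-empty s w (≰⇒> a≰b) = refl

count-shift : ∀ s w a b → count s w (suc a) (suc b) ≡ count s (λ k → w (suc k)) a b
count-shift s w a zero    = refl
count-shift s w a (suc b) with a ≤? b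
... | yes a≤b rewrite count-snoc s w (s≤s a≤b) | count-snoc s (λ k → w (suc k)) a≤b
  = cong (_+ _) (count-shift s w a b)
... | no a≰b rewrite count-empty s w (s≤s (≰⇒> a≰b)) | count-empty s (λ k → w (suc k)) (≰⇒> a≰b) = refl

count-head : ∀ s w {a b} → a < b → count s w a b ≡ indicator (does (w a ≟ₛ s)) + count s w (suc a) b
count-head s w {a} a<b
  rewrite count-split s w (n≤1+n a) a<b | count-snoc s w (≤-refl {a}) | count-empty s w (≤-refl {a}) = refl

count-head-up : ∀ w {a b} → a < b → w a ≡ u →
  count u w a b ≡ suc (count u w (suc a) b) × count d w a b ≡ count d w (suc a) b
count-head-up w a<b wa rewrite count-head u w a<b | count-head d w a<b | wa = refl , refl

count-head-down : ∀ w {a b} → a < b → w a ≡ d →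
  count u w a b ≡ count u w (suc a) b × count d w a b ≡ suc (count d w (suc a) b)
count-head-down w a<b wa rewrite count-head u w a<b | count-head d w a<b | wa = refl , refl

count-up-step : ∀ w {a k} → a ≤ k → w k ≡ u →
  count u w a (suc k) ≡ suc (count u w a k) × count d w a (suc k) ≡ count d w a k
count-up-step w a≤k wk rewrite count-snoc u w a≤k | count-snoc d w a≤k | wk =
  +-comm _ 1 , +-identityʳ _

count-down-step : ∀ w {a k} → a ≤ k → w k ≡ d →
  count u w a (suc k) ≡ count u w a k × count d w a (suc k) ≡ suc (count d w a k)
count-down-step w a≤k wk rewrite count-snoc u w a≤k | count-snoc d w a≤k | wk =
  +-identityʳ _ , +-comm _ 1

record Matchℕ (w : Wordℕ) (i j : ℕ) : Set where
  constructor matchℕ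
  field
    i<j      : i < j
    opens    : w i ≡ u
    closes   : w j ≡ d
    balanced : count u w i (suc j) ≡ count d w i (suc j)
    positive : ∀ k → i < k → k ≤ j → count d w i k < count u w i k

Pairedℕ : Wordℕ → ℕ → ℕ → Set
Pairedℕ w a b = Matchℕ w a b ⊎ Matchℕ w b a

Pairedℕ-sym : ∀ {w a b} → Pairedℕ w a b → Pairedℕ w b a
Pairedℕ-sym (inj₁ m) = inj₂ m
Pairedℕ-sym (inj₂ m) = inj₁ m

IsDyckℕ : ℕ → Wordℕ → Set
IsDyckℕ n w = count u w 0 (2 * n) ≡ n × count d w 0 (2 * n) ≡ n ×
  (∀ k → k ≤ 2 * n → count d w 0 k ≤ count u w 0 k)

+-<-≤-≢ : ∀ {x y z t} → x < y → z ≤ t → x + z ≢ y + t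
+-<-≤-≢ x<y z≤t = <⇒≢ (+-mono-<-≤ x<y z≤t)

+-≤-<-≢ : ∀ {x y z t} → x ≤ y → z < t → x + z ≢ y + t
+-≤-<-≢ {x} {y} {z} {t} x≤y z<t eq = +-<-≤-≢ z<t x≤y (trans (+-comm z x) (trans eq (+-comm y t)))

module _ {w : Wordℕ} where
  open Matchℕ

  match-suffix-negative : ∀ {i j k} → Matchℕ w i j → i < k → k ≤ j →
    count u w k (suc j) < count d w k (suc j)
  match-suffix-negative {i} {j} {k} m i<k k≤j with count u w k (suc j) <? count d w k (suc j)
  ... | yes lt = lt
  ... | no ≮ = ⊥-elim (+-<-≤-≢ (positive m k i<k k≤j) (≮⇒≥ ≮) (begin
    count d w i k + count d w k (suc j) ≡⟨ count-split d w (<⇒≤ i<k) (m≤n⇒m≤1+n k≤j) ⟨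
    count d w i (suc j)                 ≡⟨ balanced m ⟨
    count u w i (suc j)                 ≡⟨ count-split u w (<⇒≤ i<k) (m≤n⇒m≤1+n k≤j) ⟩
    count u w i k + count u w k (suc j) ∎))
    where open ≡-Reasoning

  Matchℕ-functional : ∀ {a b c} → Matchℕ w a b → Matchℕ w a c → b ≡ c
  Matchℕ-functional {a} {b} {c} mb mc with <-cmp b c
  ... | tri≈ _ b≡c _ = b≡c
  ... | tri< b<c _ _ = ⊥-elim (<⇒≢ (positive mc (suc b) (m<n⇒m<1+n (i<j mb)) b<c) (sym (balanced mb)))
  ... | tri> _ _ c<b = ⊥-elim (<⇒≢ (positive mb (suc c) (m<n⇒m<1+n (i<j mc)) c<b) (sym (balanced mc)))

  Matchℕ-injective : ∀ {a b c} → Matchℕ w a b → Matchℕ w c b → a ≡ c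
  Matchℕ-injective {a} {b} {c} ma mc with <-cmp a c
  ... | tri≈ _ a≡c _ = a≡c
  ... | tri< a<c _ _ = ⊥-elim (<-irrefl (balanced mc) (match-suffix-negative ma a<c (<⇒≤ (i<j mc))))
  ... | tri> _ _ c<a = ⊥-elim (<-irrefl (balanced ma) (match-suffix-negative mc c<a (<⇒≤ (i<j ma))))

  Matchℕ-noncrossing : ∀ {a b c e} → Matchℕ w a b → Matchℕ w c e → a < c → c < b → b < e → ⊥
  Matchℕ-noncrossing {a} {b} {c} {e} mab mce a<c c<b b<e =
    <-asym (match-suffix-negative mab a<c (<⇒≤ c<b)) (positive mce (suc b) (m<n⇒m<1+n c<b) b<e)

  Pairedℕ-functional : ∀ {a b c} → Pairedℕ w a b → Pairedℕ w a c → b ≡ c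
  Pairedℕ-functional (inj₁ x) (inj₁ y) = Matchℕ-functional x y
  Pairedℕ-functional (inj₂ x) (inj₂ y) = Matchℕ-injective x y
  Pairedℕ-functional (inj₁ x) (inj₂ y) with () ← trans (sym (opens x)) (closes y)
  Pairedℕ-functional (inj₂ x) (inj₁ y) with () ← trans (sym (opens y)) (closes x)

  Pairedℕ-noncrossing : ∀ {a b c e} → Pairedℕ w a b → Pairedℕ w c e → a < c → c < b → b < e → ⊥
  Pairedℕ-noncrossing (inj₁ x) (inj₁ y) a<c c<b b<e = Matchℕ-noncrossing x y a<c c<b b<e
  Pairedℕ-noncrossing (inj₂ x) _        a<c c<b b<e = <-asym (i<j x) (<-trans a<c c<b)
  Pairedℕ-noncrossing (inj₁ x) (inj₂ y) a<c c<b b<e = <-asym (i<j y) (<-trans c<b b<e)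

module _ {P : ℕ → Set} (P? : ∀ k → Dec (P k)) where

  private
    first-failure′ : ∀ ℓ {m} → P m → ¬ P (m + ℓ) →
      ∃ λ k → m ≤ k × k < m + ℓ × (∀ t → m ≤ t → t ≤ k → P t) × ¬ P (suc k)
    first-failure′ zero    {m} pm ¬pM = ⊥-elim (¬pM (subst P (sym (+-identityʳ m)) pm))
    first-failure′ (suc ℓ) {m} pm ¬pM with P? (suc m)
    ... | no ¬psm = m , ≤-refl , m<m+n m z<s , (λ t m≤t t≤m → subst P (≤-antisym m≤t t≤m) pm) , ¬psm
    ... | yes psm with k , sm≤k , k<M , holds , ¬psk ← first-failure′ ℓ psm (subst (¬_ ∘ P) (+-suc m ℓ) ¬pM)
      = k , <⇒≤ sm≤k , subst (k <_) (sym (+-suc m ℓ)) k<M , extend , ¬psk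
      where
      extend : ∀ t → m ≤ t → t ≤ k → P t
      extend t m≤t t≤k with m≤n⇒m<n∨m≡n m≤t
      ... | inj₁ m<t = holds t m<t t≤k
      ... | inj₂ refl = pm

    last-failure′ : ∀ ℓ {m} → ¬ P m → P (m + ℓ) →
      ∃ λ i → m ≤ i × i < m + ℓ × ¬ P i × (∀ t → i < t → t ≤ m + ℓ → P t)
    last-failure′ zero    {m} ¬pm pM = ⊥-elim (¬pm (subst P (+-identityʳ m) pM))
    last-failure′ (suc ℓ) {m} ¬pm pM with P? (m + ℓ)
    ... | no ¬pi = m + ℓ , m≤m+n m ℓ , +-monoʳ-< m (n<1+n ℓ) , ¬pi ,
      λ t i<t t≤M → subst P (sym (≤-antisym t≤M (subst (_≤ t) (sym (+-suc m ℓ)) i<t))) pM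
    ... | yes pi with i , m≤i , i<M , ¬pi , holds ← last-failure′ ℓ ¬pm pi
      = i , m≤i , <-trans i<M (+-monoʳ-< m (n<1+n ℓ)) , ¬pi , extend
      where
      extend : ∀ t → i < t → t ≤ m + suc ℓ → P t
      extend t i<t t≤M with m≤n⇒m<n∨m≡n t≤M
      ... | inj₁ t<M = holds t i<t (≤-pred (subst (t <_) (+-suc m ℓ) t<M))
      ... | inj₂ refl = pM

  first-failure : ∀ {m M} → m ≤ M → P m → ¬ P M →
    ∃ λ k → m ≤ k × k < M × (∀ t → m ≤ t → t ≤ k → P t) × ¬ P (suc k)
  first-failure {m} {M} m≤M pm ¬pM
    with k , m≤k , k<M , holds , ¬psk ← first-failure′ (M ∸ m) pm (subst (¬_ ∘ P) (sym (m+[n∸m]≡n m≤M)) ¬pM)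
    = k , m≤k , subst (k <_) (m+[n∸m]≡n m≤M) k<M , holds , ¬psk

  last-failure : ∀ {m M} → m ≤ M → ¬ P m → P M →
    ∃ λ i → m ≤ i × i < M × ¬ P i × (∀ t → i < t → t ≤ M → P t)
  last-failure {m} {M} m≤M ¬pm pM
    with i , m≤i , i<M , ¬pi , holds ← last-failure′ (M ∸ m) ¬pm (subst P (sym (m+[n∸m]≡n m≤M)) pM)
    = i , m≤i , subst (i <_) (m+[n∸m]≡n m≤M) i<M , ¬pi ,
      λ t i<t t≤M → holds t i<t (subst (t ≤_) (sym (m+[n∸m]≡n m≤M)) t≤M)

≢u⇒≡d : ∀ {s} → s ≢ u → s ≡ d
≢u⇒≡d {u} s≢u = ⊥-elim (s≢u refl)
≢u⇒≡d {d} _   = refl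

≢d⇒≡u : ∀ {s} → s ≢ d → s ≡ u
≢d⇒≡u {u} _   = refl
≢d⇒≡u {d} s≢d = ⊥-elim (s≢d refl)

<∧≮suc⇒≡suc : ∀ {x y} → x < y → ¬ suc x < y → y ≡ suc x
<∧≮suc⇒≡suc x<y ¬sx<y = ≤-antisym (≮⇒≥ ¬sx<y) x<y

up-step-positive : ∀ w {a} → w a ≡ u → count d w a (suc a) < count u w a (suc a)
up-step-positive w {a} wa rewrite count-snoc u w (≤-refl {a}) | count-snoc d w (≤-refl {a}) | wa
  | count-empty u w (≤-refl {a}) | count-empty d w (≤-refl {a}) = z<s

down-step-negative : ∀ w {a} → w a ≡ d → count u w a (suc a) < count d w a (suc a)
down-step-negative w {a} wa rewrite count-snoc u w (≤-refl {a}) | count-snoc d w (≤-refl {a}) | wa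
  | count-empty u w (≤-refl {a}) | count-empty d w (≤-refl {a}) = z<s

module _ {n : ℕ} {w : Wordℕ} (dyck : IsDyckℕ n w) where
  private
    total-u : count u w 0 (2 * n) ≡ n
    total-u = proj₁ dyck
    total-d : count d w 0 (2 * n) ≡ n
    total-d = proj₁ (proj₂ dyck)
    prefix : ∀ k → k ≤ 2 * n → count d w 0 k ≤ count u w 0 k
    prefix = proj₂ (proj₂ dyck)

  dyck-suffix : ∀ {a} → a ≤ 2 * n → count u w a (2 * n) ≤ count d w a (2 * n)
  dyck-suffix {a} a≤2n with count u w a (2 * n) ≤? count d w a (2 * n)
  ... | yes le = le
  ... | no ≰ = ⊥-elim (+-≤-<-≢ (prefix a a≤2n) (≰⇒> ≰) (begin
    count d w 0 a + count d w a (2 * n) ≡⟨ count-split d w z≤n a≤2n ⟨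
    count d w 0 (2 * n)                 ≡⟨ trans total-d (sym total-u) ⟩
    count u w 0 (2 * n)                 ≡⟨ count-split u w z≤n a≤2n ⟩
    count u w 0 a + count u w a (2 * n) ∎))
    where open ≡-Reasoning

  -- The partner of an up step is where the excess of u over d, counted from it, first drops to zero.
  partner-of-up : ∀ {a} → a < 2 * n → w a ≡ u → ∃ λ j → j < 2 * n × Matchℕ w a j
  partner-of-up {a} a<2n wa
    with k , a<k , k<2n , positive , ¬excess ← first-failure (λ k → count d w a k <? count u w a k) a<2n (up-step-positive w wa)
           (≤⇒≯ (dyck-suffix (<⇒≤ a<2n)))
    = k , k<2n , matchℕ a<k wa wk balanced positive
    where
    excess : count d w a k < count u w a k
    excess = positive k a<k ≤-refl
    wk : w k ≡ d
    wk = ≢u⇒≡d λ wk≡u → ¬excess (subst₂ _<_ (sym (proj₂ (count-up-step w (<⇒≤ a<k) wk≡u)))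
                                            (sym (proj₁ (count-up-step w (<⇒≤ a<k) wk≡u))) (m<n⇒m<1+n excess))
    balanced : count u w a (suc k) ≡ count d w a (suc k)
    balanced with count-u , count-d ← count-down-step w (<⇒≤ a<k) wk
      = trans count-u (trans (<∧≮suc⇒≡suc excess (subst₂ (λ x y → ¬ x < y) count-d count-u ¬excess)) (sym count-d))

  partner-of-down : ∀ {a} → a < 2 * n → w a ≡ d → ∃ λ i → Matchℕ w i a
  partner-of-down {a} a<2n wa
    with i , _ , i<a , ¬deficit , deficit ← last-failure (λ t → count u w t (suc a) <? count d w t (suc a)) z≤n
           (≤⇒≯ (prefix (suc a) a<2n)) (down-step-negative w wa)
    = i , matchℕ i<a wi wa balanced positive
    where
    deficit₁ : count u w (suc i) (suc a) < count d w (suc i) (suc a)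
    deficit₁ = deficit (suc i) ≤-refl i<a
    wi : w i ≡ u
    wi = ≢d⇒≡u λ wi≡d → let count-u , count-d = count-head-down w (m<n⇒m<1+n i<a) wi≡d in
      ¬deficit (subst₂ _<_ (sym count-u) (sym count-d) (m<n⇒m<1+n deficit₁))
    head-u : count u w i (suc a) ≡ suc (count u w (suc i) (suc a))
    head-u = proj₁ (count-head-up w (m<n⇒m<1+n i<a) wi)
    head-d : count d w i (suc a) ≡ count d w (suc i) (suc a)
    head-d = proj₂ (count-head-up w (m<n⇒m<1+n i<a) wi)
    balanced : count u w i (suc a) ≡ count d w i (suc a)
    balanced = trans head-u (trans (sym (<∧≮suc⇒≡suc deficit₁ (subst₂ (λ x y → ¬ x < y) head-u head-d ¬deficit)))
                                   (sym head-d))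
    positive : ∀ k → i < k → k ≤ a → count d w i k < count u w i k
    positive k i<k k≤a with count d w i k <? count u w i k
    ... | yes lt = lt
    ... | no ≮ = ⊥-elim (+-≤-<-≢ (≮⇒≥ ≮) (deficit k i<k k≤a) (begin
      count u w i k + count u w k (suc a) ≡⟨ count-split u w (<⇒≤ i<k) (m≤n⇒m≤1+n k≤a) ⟨
      count u w i (suc a)                 ≡⟨ balanced ⟩
      count d w i (suc a)                 ≡⟨ count-split d w (<⇒≤ i<k) (m≤n⇒m≤1+n k≤a) ⟩
      count d w i k + count d w k (suc a) ∎))
      where open ≡-Reasoning

record PerfectMatching (N : ℕ) (M : ℕ → ℕ → Set) : Set where
  field
    symmetric   : ∀ {a b} → M a b → M b a
    bounded     : ∀ {a b} → M a b → a < N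
    total       : ∀ {a} → a < N → ∃ (M a)
    functional  : ∀ {a b c} → M a b → M a c → b ≡ c
    irreflexive : ∀ {a} → ¬ M a a

NonCrossing : (ℕ → ℕ → Set) → Set
NonCrossing M = ∀ {a b c e} → M a b → M c e → a < c → c < b → b < e → ⊥

Tunneling : ℕ → Wordℕ → ℕ → ℕ → Set
Tunneling N w a b = a < N × b < N × Pairedℕ w a b

tunneling-noncrossing : ∀ {N w} → NonCrossing (Tunneling N w)
tunneling-noncrossing (_ , _ , p) (_ , _ , q) = Pairedℕ-noncrossing p q

tunneling-perfect : ∀ {n w} → IsDyckℕ n w → PerfectMatching (2 * n) (Tunneling (2 * n) w)
tunneling-perfect {n} {w} dyck = record
  { symmetric   = λ (a< , b< , p) → b< , a< , Pairedℕ-sym p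
  ; bounded     = proj₁
  ; total       = total
  ; functional  = λ (_ , _ , p) (_ , _ , q) → Pairedℕ-functional p q
  ; irreflexive = λ { (_ , _ , inj₁ m) → <-irrefl refl (Matchℕ.i<j m)
                    ; (_ , _ , inj₂ m) → <-irrefl refl (Matchℕ.i<j m) } }
  where
  partner : ∀ {a} → a < 2 * n → ∀ s → w a ≡ s → ∃ (Tunneling (2 * n) w a)
  partner a< u wa with j , j< , m ← partner-of-up dyck a< wa = j , a< , j< , inj₁ m
  partner a< d wa with i , m ← partner-of-down dyck a< wa = i , a< , <-trans (Matchℕ.i<j m) a< , inj₂ m
  total : ∀ {a} → a < 2 * n → ∃ (Tunneling (2 * n) w a)
  total {a} a< = partner a< (w a) refl

Matchℕ-cong : ∀ {v w i j} → (∀ k → i ≤ k → k ≤ j → v k ≡ w k) → Matchℕ v i j → Matchℕ w i j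
Matchℕ-cong {v} {w} {i} {j} eq (matchℕ i<j opens closes balanced positive) = matchℕ i<j
  (trans (sym (eq i ≤-refl (<⇒≤ i<j))) opens)
  (trans (sym (eq j (<⇒≤ i<j) ≤-refl)) closes)
  (trans (sym (count-cong u eq′)) (trans balanced (count-cong d eq′)))
  (λ k i<k k≤j → subst₂ _<_ (count-cong d (eq″ k≤j)) (count-cong u (eq″ k≤j)) (positive k i<k k≤j))
  where
  eq′ : ∀ k → i ≤ k → k < suc j → v k ≡ w k
  eq′ k i≤k k<sj = eq k i≤k (≤-pred k<sj)
  eq″ : ∀ {l} → l ≤ j → ∀ k → i ≤ k → k < l → v k ≡ w k
  eq″ l≤j k i≤k k<l = eq k i≤k (≤-trans (<⇒≤ k<l) l≤j)

Matchℕ-shift⁺ : ∀ {w i j} → Matchℕ (w ∘ suc) i j → Matchℕ w (suc i) (suc j)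
Matchℕ-shift⁺ {w} {i} {j} (matchℕ i<j opens closes balanced positive) = matchℕ (s≤s i<j) opens closes
  (trans (count-shift u w i (suc j)) (trans balanced (sym (count-shift d w i (suc j)))))
  λ { (suc k) (s≤s i<k) (s≤s k≤j) → subst₂ _<_ (sym (count-shift d w i k)) (sym (count-shift u w i k)) (positive k i<k k≤j) }

Matchℕ-shift⁻ : ∀ {w i j} → Matchℕ w (suc i) (suc j) → Matchℕ (w ∘ suc) i j
Matchℕ-shift⁻ {w} {i} {j} (matchℕ (s≤s i<j) opens closes balanced positive) = matchℕ i<j opens closes
  (trans (sym (count-shift u w i (suc j))) (trans balanced (count-shift d w i (suc j))))
  λ k i<k k≤j → subst₂ _<_ (count-shift d w i k) (count-shift u w i k) (positive (suc k) (s≤s i<k) (s≤s k≤j))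

insertUD : ℕ → Wordℕ → Wordℕ
insertUD zero    w zero          = u
insertUD zero    w (suc zero)    = d
insertUD zero    w (suc (suc k)) = w k
insertUD (suc c) w zero          = w zero
insertUD (suc c) w (suc k)       = insertUD c (w ∘ suc) k

insertUD-< : ∀ c w {k} → k < c → insertUD c w k ≡ w k
insertUD-< (suc c) w {zero}  _         = refl
insertUD-< (suc c) w {suc k} (s≤s k<c) = insertUD-< c (w ∘ suc) k<c

insertUD-at : ∀ c w → insertUD c w c ≡ u
insertUD-at zero    w = refl
insertUD-at (suc c) w = insertUD-at c (w ∘ suc)

insertUD-after : ∀ c w → insertUD c w (suc c) ≡ d
insertUD-after zero    w = refl
insertUD-after (suc c) w = insertUD-after c (w ∘ suc)

insertUD-≥ : ∀ c w {k} → c ≤ k → insertUD c w (2 + k) ≡ w k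
insertUD-≥ zero    w         _         = refl
insertUD-≥ (suc c) w {suc k} (s≤s c≤k) = insertUD-≥ c (w ∘ suc) c≤k

-- The position of the old letter p after inserting two letters at c.
skip : ℕ → ℕ → ℕ
skip zero    p       = 2 + p
skip (suc c) zero    = zero
skip (suc c) (suc p) = suc (skip c p)

skip-< : ∀ c {p} → p < c → skip c p ≡ p
skip-< (suc c) {zero}  _         = refl
skip-< (suc c) {suc p} (s≤s p<c) = cong suc (skip-< c p<c)

skip-≥ : ∀ c {p} → c ≤ p → skip c p ≡ 2 + p
skip-≥ zero    _ = refl
skip-≥ (suc c) {suc p} (s≤s c≤p) = cong suc (skip-≥ c c≤p)

skip-mono : ∀ c {p q} → p < q → skip c p < skip c q
skip-mono zero    p<q = s≤s (s≤s p<q)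
skip-mono (suc c) {zero}  {suc q} _         = z<s
skip-mono (suc c) {suc p} {suc q} (s≤s p<q) = s≤s (skip-mono c p<q)

skip-injective : ∀ c {p q} → skip c p ≡ skip c q → p ≡ q
skip-injective c {p} {q} eq with <-cmp p q
... | tri≈ _ p≡q _ = p≡q
... | tri< p<q _ _ = ⊥-elim (<⇒≢ (skip-mono c p<q) eq)
... | tri> _ _ q<p = ⊥-elim (<⇒≢ (skip-mono c q<p) (sym eq))

skip≢at : ∀ c p → skip c p ≢ c
skip≢at (suc c) (suc p) eq = skip≢at c p (suc-injective eq)

skip≢after : ∀ c p → skip c p ≢ suc c
skip≢after (suc c) (suc p) eq = skip≢after c p (suc-injective eq)

skip-<-bound : ∀ c {K p} → c ≤ K → p < K ⇔ skip c p < 2 + K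
skip-<-bound c {K} {p} c≤K = mk⇔ to from
  where
  to : p < K → skip c p < 2 + K
  to p<K with p <? c
  ... | yes p<c rewrite skip-< c p<c = <-trans p<K (m<n+m K z<s)
  ... | no p≮c rewrite skip-≥ c (≮⇒≥ p≮c) = s≤s (s≤s p<K)
  from : skip c p < 2 + K → p < K
  from lt with p <? c
  ... | yes p<c = <-≤-trans p<c c≤K
  ... | no p≮c rewrite skip-≥ c (≮⇒≥ p≮c) = ≤-pred (≤-pred lt)

data SkipView (c : ℕ) : ℕ → Set where
  at    : SkipView c c
  after : SkipView c (suc c)
  old   : ∀ p → SkipView c (skip c p)

skipView : ∀ c x → SkipView c x
skipView zero    zero          = at
skipView zero    (suc zero)    = after
skipView zero    (suc (suc p)) = old p
skipView (suc c) zero          = old zero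
skipView (suc c) (suc x) with skipView c x
... | at    = at
... | after = after
... | old p = old (suc p)

module InsertUD (c : ℕ) (w : Wordℕ) where
  W : Wordℕ
  W = insertUD c w

  count-before : ∀ s {a b} → b ≤ c → count s W a b ≡ count s w a b
  count-before s b≤c = count-cong s λ k _ k<b → insertUD-< c w (<-≤-trans k<b b≤c)

  count-after : ∀ s {a b} → c ≤ a → count s W (2 + a) (2 + b) ≡ count s w a b
  count-after s {a} {b} c≤a = begin
    count s W (2 + a) (2 + b)         ≡⟨ count-shift s W (suc a) (suc b) ⟩
    count s (W ∘ suc) (suc a) (suc b) ≡⟨ count-shift s (W ∘ suc) a b ⟩
    count s (W ∘ suc ∘ suc) a b       ≡⟨ count-cong s {a = a} {b = b} (λ k a≤k _ → insertUD-≥ c w (≤-trans c≤a a≤k)) ⟩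
    count s w a b                     ∎
    where open ≡-Reasoning

  count-inserted : ∀ s → count s W c (2 + c) ≡ 1
  count-inserted s rewrite count-snoc s W (n≤1+n c) | count-snoc s W (≤-refl {c}) | count-empty s W (≤-refl {c})
    | insertUD-at c w | insertUD-after c w = one s
    where
    one : ∀ s → indicator (does (u ≟ₛ s)) + indicator (does (d ≟ₛ s)) ≡ 1
    one u = refl
    one d = refl

  count-to-inserted-up : ∀ s {a} → a ≤ c → count s W a (suc c) ≡ count s w a c + indicator (does (u ≟ₛ s))
  count-to-inserted-up s {a} a≤c rewrite count-snoc s W a≤c | insertUD-at c w | count-before s {a} (≤-refl {c}) = refl

  count-across : ∀ s {a b} → a ≤ c → c ≤ b → count s W a (2 + b) ≡ suc (count s w a b)
  count-across s {a} {b} a≤c c≤b = begin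
    count s W a (2 + b)
      ≡⟨ count-split s W a≤c (≤-trans c≤b (m≤n+m b 2)) ⟩
    count s W a c + count s W c (2 + b)
      ≡⟨ cong₂ _+_ (count-before s (≤-refl {c})) (count-split s W (m≤n+m c 2) (s≤s (s≤s c≤b))) ⟩
    count s w a c + (count s W c (2 + c) + count s W (2 + c) (2 + b))
      ≡⟨ cong (count s w a c +_) (cong₂ _+_ (count-inserted s) (count-after s {c} {b} ≤-refl)) ⟩
    count s w a c + suc (count s w c b)
      ≡⟨ +-suc (count s w a c) _ ⟩
    suc (count s w a c + count s w c b)
      ≡⟨ cong suc (count-split s w a≤c c≤b) ⟨
    suc (count s w a b)
      ∎
    where open ≡-Reasoning

  inserted-match : Matchℕ W c (suc c)
  inserted-match = matchℕ ≤-refl (insertUD-at c w) (insertUD-after c w)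
    (trans (count-inserted u) (sym (count-inserted d)))
    λ { k c<k k≤sc → subst (λ k → count d W c k < count u W c k) (≤-antisym c<k k≤sc) (up-step-positive W (insertUD-at c w)) }

  private
    match-across⁻ : ∀ {p q} → p < c → c ≤ q → Matchℕ W p (2 + q) → Matchℕ w p q
    match-across⁻ {p} {q} p<c c≤q (matchℕ _ opens closes balanced positive) = matchℕ (<-≤-trans p<c c≤q)
      (trans (sym (insertUD-< c w p<c)) opens) (trans (sym (insertUD-≥ c w c≤q)) closes)
      (suc-injective (trans (sym (count-across u (<⇒≤ p<c) (m≤n⇒m≤1+n c≤q)))
                     (trans balanced (count-across d (<⇒≤ p<c) (m≤n⇒m≤1+n c≤q)))))
      positive′
      where
      positive′ : ∀ k → p < k → k ≤ q → count d w p k < count u w p k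
      positive′ k p<k k≤q with k ≤? c
      ... | yes k≤c = subst₂ _<_ (count-before d k≤c) (count-before u k≤c) (positive k p<k (≤-trans k≤q (m≤n+m q 2)))
      ... | no k≰c  = ≤-pred (subst₂ _<_ (count-across d (<⇒≤ p<c) (<⇒≤ (≰⇒> k≰c)))
                                          (count-across u (<⇒≤ p<c) (<⇒≤ (≰⇒> k≰c)))
                               (positive (2 + k) (<-≤-trans p<k (m≤n+m k 2)) (s≤s (s≤s k≤q))))

    match-across⁺ : ∀ {p q} → p < c → c ≤ q → Matchℕ w p q → Matchℕ W p (2 + q)
    match-across⁺ {p} {q} p<c c≤q (matchℕ p<q opens closes balanced positive) = matchℕ (<-≤-trans p<q (m≤n+m q 2))
      (trans (insertUD-< c w p<c) opens) (trans (insertUD-≥ c w c≤q) closes)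
      (trans (count-across u (<⇒≤ p<c) (m≤n⇒m≤1+n c≤q))
             (trans (cong suc balanced) (sym (count-across d (<⇒≤ p<c) (m≤n⇒m≤1+n c≤q)))))
      positive′
      where
      positive′ : ∀ k → p < k → k ≤ 2 + q → count d W p k < count u W p k
      positive′ k p<k k≤ with k ≤? c
      ... | yes k≤c = subst₂ _<_ (sym (count-before d k≤c)) (sym (count-before u k≤c)) (positive k p<k (≤-trans k≤c c≤q))
      ... | no k≰c with m≤n⇒m<n∨m≡n (≰⇒> k≰c)
      ...   | inj₂ refl = subst₂ _<_ (sym (count-to-inserted-up d (<⇒≤ p<c))) (sym (count-to-inserted-up u (<⇒≤ p<c)))
                            (subst₂ _<_ (sym (+-identityʳ _)) (+-comm 1 _) (m<n⇒m<1+n (positive c p<c c≤q)))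
      positive′ (suc (suc k)) p<k (s≤s (s≤s k≤q)) | no _ | inj₁ (s≤s (s≤s c≤k)) =
        subst₂ _<_ (sym (count-across d (<⇒≤ p<c) c≤k)) (sym (count-across u (<⇒≤ p<c) c≤k))
          (s≤s (positive k (<-≤-trans p<c c≤k) k≤q))

  match-skip : ∀ {p q} → Matchℕ W (skip c p) (skip c q) ⇔ Matchℕ w p q
  match-skip {p} {q} with p <? c | q <? c
  ... | yes p<c | yes q<c rewrite skip-< c p<c | skip-< c q<c = mk⇔
    (Matchℕ-cong λ k _ k≤q → insertUD-< c w (≤-<-trans k≤q q<c))
    (Matchℕ-cong λ k _ k≤q → sym (insertUD-< c w (≤-<-trans k≤q q<c)))
  ... | no p≮c | no q≮c rewrite skip-≥ c (≮⇒≥ p≮c) | skip-≥ c (≮⇒≥ q≮c) = mk⇔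
    (Matchℕ-cong (λ k p≤k _ → insertUD-≥ c w (≤-trans (≮⇒≥ p≮c) p≤k)) ∘ Matchℕ-shift⁻ ∘ Matchℕ-shift⁻)
    (Matchℕ-shift⁺ ∘ Matchℕ-shift⁺ ∘ Matchℕ-cong (λ k p≤k _ → sym (insertUD-≥ c w (≤-trans (≮⇒≥ p≮c) p≤k))))
  ... | yes p<c | no q≮c rewrite skip-< c p<c | skip-≥ c (≮⇒≥ q≮c) = mk⇔
    (match-across⁻ p<c (≮⇒≥ q≮c)) (match-across⁺ p<c (≮⇒≥ q≮c))
  ... | no p≮c | yes q<c rewrite skip-≥ c (≮⇒≥ p≮c) | skip-< c q<c = mk⇔
    (λ m → ⊥-elim (<-asym (Matchℕ.i<j m) (<-≤-trans q<c (≤-trans (≮⇒≥ p≮c) (m≤n+m p 2)))))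
    (λ m → ⊥-elim (<-asym (Matchℕ.i<j m) (<-≤-trans q<c (≮⇒≥ p≮c))))

  paired-skip : ∀ {p q} → Pairedℕ W (skip c p) (skip c q) ⇔ Pairedℕ w p q
  paired-skip = mk⇔ (⊎.map (Equivalence.to match-skip) (Equivalence.to match-skip))
                    (⊎.map (Equivalence.from match-skip) (Equivalence.from match-skip))

  insertUD-dyck : ∀ {n} → IsDyckℕ n w → c ≤ 2 * n → IsDyckℕ (suc n) W
  insertUD-dyck {n} (total-u , total-d , prefix) c≤2n =
    subst (λ N → count u W 0 N ≡ suc n) (sym (*-suc 2 n)) (trans (count-across u z≤n c≤2n) (cong suc total-u)) ,
    subst (λ N → count d W 0 N ≡ suc n) (sym (*-suc 2 n)) (trans (count-across d z≤n c≤2n) (cong suc total-d)) ,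
    λ k k≤ → prefix′ k (subst (k ≤_) (*-suc 2 n) k≤)
    where
    prefix′ : ∀ k → k ≤ 2 + 2 * n → count d W 0 k ≤ count u W 0 k
    prefix′ k k≤ with k ≤? c
    ... | yes k≤c = subst₂ _≤_ (sym (count-before d k≤c)) (sym (count-before u k≤c)) (prefix k (≤-trans k≤c c≤2n))
    ... | no k≰c with m≤n⇒m<n∨m≡n (≰⇒> k≰c)
    ...   | inj₂ refl = subst₂ _≤_ (sym (count-to-inserted-up d z≤n)) (sym (count-to-inserted-up u z≤n))
                          (subst₂ _≤_ (sym (+-identityʳ _)) (+-comm 1 _) (m≤n⇒m≤1+n (prefix c c≤2n)))
    prefix′ (suc (suc k)) (s≤s (s≤s k≤2n)) | no _ | inj₁ (s≤s (s≤s c≤k)) =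
      subst₂ _≤_ (sym (count-across d z≤n c≤k)) (sym (count-across u z≤n c≤k)) (s≤s (prefix k k≤2n))

module _ {N : ℕ} {M : ℕ → ℕ → Set} (perfect : PerfectMatching N M) (noncrossing : NonCrossing M) where
  open PerfectMatching perfect

  private
    -- Inside a chord (a, b) with a + 1 < b lies the chord of a + 1, which is shorter.
    innermost : ∀ fuel {a b} → b ≤ a + fuel → M a b → a < b → ∃ λ c → M c (suc c)
    innermost zero    {a} {b} b≤a+0 _ a<b = ⊥-elim (<⇒≱ a<b (subst (b ≤_) (+-identityʳ a) b≤a+0))
    innermost (suc fuel) {a} {b} b≤ mab a<b with m≤n⇒m<n∨m≡n a<b
    ... | inj₂ refl = a , mab
    ... | inj₁ sa<b with e , me ← total (<-trans sa<b (bounded (symmetric mab))) with <-cmp e a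
    ...   | tri< e<a _ _ = ⊥-elim (noncrossing (symmetric me) mab e<a (n<1+n a) sa<b)
    ...   | tri≈ _ refl _ = ⊥-elim (<-irrefl (sym (functional mab (symmetric me))) sa<b)
    ...   | tri> _ _ a<e with m≤n⇒m<n∨m≡n a<e
    ...     | inj₂ refl = ⊥-elim (irreflexive me)
    ...     | inj₁ sa<e with <-cmp e b
    ...       | tri≈ _ refl _ = ⊥-elim (<-irrefl (functional (symmetric mab) (symmetric me)) (n<1+n a))
    ...       | tri> _ _ b<e = ⊥-elim (noncrossing mab me (n<1+n a) sa<b b<e)
    ...       | tri< e<b _ _ = innermost fuel (m≤n⇒m≤1+n (≤-pred (≤-trans e<b (subst (b ≤_) (+-suc a fuel) b≤)))) me sa<e

  adjacent-chord : 0 < N → ∃ λ c → M c (suc c)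
  adjacent-chord 0<N with b , m0b ← total 0<N =
    innermost b ≤-refl m0b (n≢0⇒n>0 λ { refl → irreflexive m0b })

module RemoveChord {K : ℕ} {M : ℕ → ℕ → Set} (perfect : PerfectMatching (2 + K) M) (noncrossing : NonCrossing M)
                   {c : ℕ} (chord : M c (suc c)) where
  open PerfectMatching perfect

  c≤K : c ≤ K
  c≤K = ≤-pred (≤-pred (bounded (symmetric chord)))

  M′ : ℕ → ℕ → Set
  M′ p q = M (skip c p) (skip c q)

  private
    old-partner : ∀ {p x} → M (skip c p) x → SkipView c x → ∃ λ q → x ≡ skip c q
    old-partner {p} m at    = ⊥-elim (skip≢after c p (functional (symmetric m) chord))
    old-partner {p} m after = ⊥-elim (skip≢at c p (functional (symmetric m) (symmetric chord)))
    old-partner     m (old q) = q , refl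

  M′-perfect : PerfectMatching K M′
  M′-perfect = record
    { symmetric   = symmetric
    ; bounded     = λ m → Equivalence.from (skip-<-bound c c≤K) (bounded m)
    ; total       = total′
    ; functional  = λ m m′ → skip-injective c (functional m m′)
    ; irreflexive = irreflexive }
    where
    total′ : ∀ {p} → p < K → ∃ (M′ p)
    total′ {p} p<K with x , m ← total (Equivalence.to (skip-<-bound c c≤K) p<K)
                   with q , refl ← old-partner m (skipView c x) = q , m

  M′-noncrossing : NonCrossing M′
  M′-noncrossing m m′ p<r r<q q<t = noncrossing m m′ (skip-mono c p<r) (skip-mono c r<q) (skip-mono c q<t)

  module _ {w′ : Wordℕ} (tunneling′ : ∀ {a b} → Tunneling K w′ a b ⇔ M′ a b) where
    open InsertUD c w′

    private
      inserted : Pairedℕ W c (suc c)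
      inserted = inj₁ inserted-match

      tunneling-to : ∀ {a b} → Pairedℕ W a b → SkipView c a → SkipView c b → a < 2 + K → b < 2 + K → M a b
      tunneling-to P at      _        _ _ rewrite Pairedℕ-functional P inserted = chord
      tunneling-to P after   _        _ _ rewrite Pairedℕ-functional P (Pairedℕ-sym inserted) = symmetric chord
      tunneling-to P (old p) at      _ _ = ⊥-elim (skip≢after c p (Pairedℕ-functional (Pairedℕ-sym P) inserted))
      tunneling-to P (old p) after   _ _ = ⊥-elim (skip≢at c p (Pairedℕ-functional (Pairedℕ-sym P) (Pairedℕ-sym inserted)))
      tunneling-to P (old p) (old q) a< b< = Equivalence.to tunneling′
        (Equivalence.from (skip-<-bound c c≤K) a< , Equivalence.from (skip-<-bound c c≤K) b< ,
         Equivalence.to paired-skip P)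

      pairing-from : ∀ {a b} → M a b → SkipView c a → SkipView c b → Pairedℕ W a b
      pairing-from m at    _ rewrite functional m chord = inserted
      pairing-from m after _ rewrite functional m (symmetric chord) = Pairedℕ-sym inserted
      pairing-from m (old p) at    = ⊥-elim (skip≢after c p (functional (symmetric m) chord))
      pairing-from m (old p) after = ⊥-elim (skip≢at c p (functional (symmetric m) (symmetric chord)))
      pairing-from m (old p) (old q) = Equivalence.from paired-skip (proj₂ (proj₂ (Equivalence.from tunneling′ m)))

    tunneling : ∀ {a b} → Tunneling (2 + K) W a b ⇔ M a b
    tunneling {a} {b} = mk⇔
      (λ (a< , b< , P) → tunneling-to P (skipView c a) (skipView c b) a< b<)
      (λ m → bounded m , bounded (symmetric m) , pairing-from m (skipView c a) (skipView c b))

noncrossing⇒tunneling : ∀ n {M} → PerfectMatching (2 * n) M → NonCrossing M →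
  ∃ λ w → IsDyckℕ n w × (∀ {a b} → Tunneling (2 * n) w a b ⇔ M a b)
noncrossing⇒tunneling zero perfect _ =
  (λ _ → u) , (refl , refl , λ { zero _ → z≤n }) ,
  mk⇔ (λ (a<0 , _) → ⊥-elim (n≮0 a<0)) (λ m → ⊥-elim (n≮0 (PerfectMatching.bounded perfect m)))
noncrossing⇒tunneling (suc n) {M} perfect noncrossing =
  extend (subst (λ N → PerfectMatching N M) (*-suc 2 n) perfect)
  where
  cast : ∀ {w} → (∀ {a b} → Tunneling (2 + 2 * n) w a b ⇔ M a b) → (∀ {a b} → Tunneling (2 * suc n) w a b ⇔ M a b)
  cast rewrite *-suc 2 n = λ t → t
  extend : PerfectMatching (2 + 2 * n) M → ∃ λ w → IsDyckℕ (suc n) w × (∀ {a b} → Tunneling (2 * suc n) w a b ⇔ M a b)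
  extend perfect′ with c , chord ← adjacent-chord perfect′ noncrossing z<s = let open RemoveChord perfect′ noncrossing chord in
    let w′ , dyck′ , tunneling′ = noncrossing⇒tunneling n M′-perfect M′-noncrossing in
    insertUD c w′ , InsertUD.insertUD-dyck c w′ dyck′ c≤K , cast (tunneling tunneling′)

length-filter-tabulate : ∀ {A B : Set} {P : Pred A 0ℓ} {Q : Pred B 0ℓ} (P? : Decidable P) (Q? : Decidable Q)
  {m} (f : Fin m → A) (g : Fin m → B) → (∀ i → P (f i) ⇔ Q (g i)) →
  length (filter P? (tabulate f)) ≡ length (filter Q? (tabulate g))
length-filter-tabulate P? Q? {zero}  f g _ = refl
length-filter-tabulate P? Q? {suc m} f g P⇔Q with P? (f Fin.zero) | Q? (g Fin.zero)
... | yes _ | yes _ = cong suc (length-filter-tabulate P? Q? (f ∘ Fin.suc) (g ∘ Fin.suc) (P⇔Q ∘ Fin.suc))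
... | no _  | no _  = length-filter-tabulate P? Q? (f ∘ Fin.suc) (g ∘ Fin.suc) (P⇔Q ∘ Fin.suc)
... | yes p | no ¬q = ⊥-elim (¬q (Equivalence.to (P⇔Q Fin.zero) p))
... | no ¬p | yes q = ⊥-elim (¬p (Equivalence.from (P⇔Q Fin.zero) q))

tabulate-toℕ : ∀ m → tabulate {n = m} toℕ ≡ upTo m
tabulate-toℕ m = go m id
  where
  go : ∀ m (f : ℕ → ℕ) → tabulate {n = m} (f ∘ toℕ) ≡ applyUpTo f m
  go zero    f = refl
  go (suc m) f = cong (f 0 ∷_) (go m (f ∘ suc))

length-filter-upTo-suc : ∀ {P : Pred ℕ 0ℓ} (P? : Decidable P) M →
  length (filter P? (upTo (suc M))) ≡ length (filter P? (upTo M)) + indicator (does (P? M))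
length-filter-upTo-suc P? M = begin
  length (filter P? (upTo (suc M)))                         ≡⟨ cong (length ∘ filter P?) (upTo-∷ʳ M) ⟨
  length (filter P? (upTo M ++ [ M ]))                      ≡⟨ cong length (filter-++ P? (upTo M) [ M ]) ⟩
  length (filter P? (upTo M) ++ filter P? [ M ])            ≡⟨ length-++ (filter P? (upTo M)) ⟩
  length (filter P? (upTo M)) + length (filter P? [ M ])    ≡⟨ cong (length (filter P? (upTo M)) +_) singleton ⟩
  length (filter P? (upTo M)) + indicator (does (P? M))     ∎
  where
  open ≡-Reasoning
  singleton : length (filter P? [ M ]) ≡ indicator (does (P? M))
  singleton with P? M
  ... | yes _ = refl
  ... | no  _ = refl

module _ (s : Step) (w : Wordℕ) (a b : ℕ) where
  InCount : Pred ℕ 0ℓ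
  InCount k = a ≤ k × k < b × w k ≡ s

  inCount? : Decidable InCount
  inCount? k = (a ≤? k) ×-dec ((k <? b) ×-dec (w k ≟ₛ s))

  private
    length-filter-upTo-≤ : ∀ M → M ≤ b → length (filter inCount? (upTo M)) ≡ count s w a M
    length-filter-upTo-≤ zero    _ = refl
    length-filter-upTo-≤ (suc M) M<b rewrite length-filter-upTo-suc inCount? M
      | length-filter-upTo-≤ M (<⇒≤ M<b) | dec-true (M <? b) M<b = refl

  length-filter-upTo : ∀ M → b ≤ M → length (filter inCount? (upTo M)) ≡ count s w a b
  length-filter-upTo M b≤M with m≤n⇒m<n∨m≡n b≤M
  ... | inj₂ refl = length-filter-upTo-≤ b ≤-refl
  length-filter-upTo (suc M) _ | inj₁ (s≤s b≤M) rewrite length-filter-upTo-suc inCount? M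
    | length-filter-upTo M b≤M | dec-false (M <? b) (≤⇒≯ b≤M) | ∧-zeroʳ (does (a ≤? M)) = +-identityʳ _

_Extends_ : ∀ {m} → Wordℕ → Word m → Set
w Extends D = ∀ i → w (toℕ i) ≡ D i

extend : ∀ {m} → Word m → Wordℕ
extend {zero}  D _       = d
extend {suc m} D zero    = D Fin.zero
extend {suc m} D (suc k) = extend (D ∘ Fin.suc) k

extend-Extends : ∀ {m} (D : Word m) → extend D Extends D
extend-Extends D Fin.zero    = refl
extend-Extends D (Fin.suc i) = extend-Extends (D ∘ Fin.suc) i

module _ {m : ℕ} {D : Word m} {w : Wordℕ} (ext : w Extends D) where

  cnt≡count : ∀ s a {b} → b ≤ m → cnt s D a b ≡ count s w a b
  cnt≡count s a {b} b≤m = begin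
    cnt s D a b                                               ≡⟨ length-filter-tabulate _ (inCount? s w a b) id toℕ agree ⟩
    length (filter (inCount? s w a b) (tabulate {n = m} toℕ)) ≡⟨ cong (length ∘ filter (inCount? s w a b)) (tabulate-toℕ m) ⟩
    length (filter (inCount? s w a b) (upTo m))               ≡⟨ length-filter-upTo s w a b m b≤m ⟩
    count s w a b                                             ∎
    where
    open ≡-Reasoning
    agree : ∀ i → (a ≤ toℕ i × toℕ i < b × D i ≡ s) ⇔ InCount s w a b (toℕ i)
    agree i rewrite ext i = mk⇔ id id

  Match⇔Matchℕ : ∀ {i j} → Match D i j ⇔ Matchℕ w (toℕ i) (toℕ j)
  Match⇔Matchℕ {i} {j} = mk⇔
    (λ (i<j , opens , closes , balanced , positive) → matchℕ i<j (trans (ext i) opens) (trans (ext j) closes)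
      (trans (sym (cnt≡count u _ (toℕ<n j))) (trans balanced (cnt≡count d _ (toℕ<n j))))
      λ k i<k k≤j → subst₂ _<_ (cnt≡count d _ (bound k≤j)) (cnt≡count u _ (bound k≤j)) (positive k i<k k≤j))
    (λ (matchℕ i<j opens closes balanced positive) → i<j , trans (sym (ext i)) opens , trans (sym (ext j)) closes ,
      trans (cnt≡count u _ (toℕ<n j)) (trans balanced (sym (cnt≡count d _ (toℕ<n j)))) ,
      λ k i<k k≤j → subst₂ _<_ (sym (cnt≡count d _ (bound k≤j))) (sym (cnt≡count u _ (bound k≤j))) (positive k i<k k≤j))
    where
    bound : ∀ {k} → k ≤ toℕ j → k ≤ m
    bound k≤j = ≤-trans k≤j (<⇒≤ (toℕ<n j))

  Paired⇔Pairedℕ : ∀ {a b} → Paired D a b ⇔ Pairedℕ w (toℕ a) (toℕ b)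
  Paired⇔Pairedℕ = mk⇔ (⊎.map (Equivalence.to Match⇔Matchℕ) (Equivalence.to Match⇔Matchℕ))
                       (⊎.map (Equivalence.from Match⇔Matchℕ) (Equivalence.from Match⇔Matchℕ))

IsDyck⇔IsDyckℕ : ∀ {n} {D : Word (2 * n)} {w} → w Extends D → IsDyck n D ⇔ IsDyckℕ n w
IsDyck⇔IsDyckℕ {n} ext = mk⇔
  (λ (total-u , total-d , prefix) →
    trans (sym (cnt≡count ext u 0 ≤-refl)) total-u , trans (sym (cnt≡count ext d 0 ≤-refl)) total-d ,
    λ k k≤ → subst₂ _≤_ (cnt≡count ext d 0 k≤) (cnt≡count ext u 0 k≤) (prefix k k≤))
  (λ (total-u , total-d , prefix) →
    trans (cnt≡count ext u 0 ≤-refl) total-u , trans (cnt≡count ext d 0 ≤-refl) total-d ,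
    λ k k≤ → subst₂ _≤_ (sym (cnt≡count ext d 0 k≤)) (sym (cnt≡count ext u 0 k≤)) (prefix k k≤))

Tunneling⇔Pairedℕ : ∀ {N w} {i j : Fin N} → Tunneling N w (toℕ i) (toℕ j) ⇔ Pairedℕ w (toℕ i) (toℕ j)
Tunneling⇔Pairedℕ {i = i} {j} = mk⇔ (proj₂ ∘ proj₂) (λ p → toℕ<n i , toℕ<n j , p)

PreservesNonCrossing : ℕ → (ℕ → ℕ) → Set₁
PreservesNonCrossing N φ = ∀ {M : ℕ → ℕ → Set} → (∀ {a b} → M a b → M b a) → NonCrossing M →
  NonCrossing (λ x y → x < N × y < N × M (φ x) (φ y))

-- φ is the action of γ⁻¹ on positions; D^γ is found as the path whose tunneling is the pull-back of τ_D along φ.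
path-after : ∀ n (γ : Fin (2 * n) → Fin (2 * n)) (φ : ℕ → ℕ) →
  (∀ i → φ (toℕ (γ i)) ≡ toℕ i) →
  (∀ {x} → x < 2 * n → φ x < 2 * n) →
  (∀ {x y} → x < 2 * n → y < 2 * n → φ x ≡ φ y → x ≡ y) →
  PreservesNonCrossing (2 * n) φ →
  ∀ D → IsDyck n D → IsPathAfter n D γ
path-after n γ φ φ∘γ φ-bound φ-injective preserves D dyck =
  w ∘ toℕ , Equivalence.from (IsDyck⇔IsDyckℕ {n} (λ _ → refl)) dyck′ , λ a b → begin
    Paired (w ∘ toℕ) (γ a) (γ b)            ≈⟨ Paired⇔Pairedℕ (λ _ → refl) ⟩
    Pairedℕ w (toℕ (γ a)) (toℕ (γ b))       ≈⟨ Tunneling⇔Pairedℕ ⟨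
    Tunneling N w (toℕ (γ a)) (toℕ (γ b))   ≈⟨ tunneling′ ⟩
    M (toℕ (γ a)) (toℕ (γ b))               ≈⟨ M∘γ ⟩
    T (toℕ a) (toℕ b)                       ≈⟨ Tunneling⇔Pairedℕ ⟩
    Pairedℕ (extend D) (toℕ a) (toℕ b)      ≈⟨ Paired⇔Pairedℕ (extend-Extends D) ⟨
    Paired D a b                            ∎
  where
  open SetoidReasoning (⇔.⇔-setoid 0ℓ)
  N : ℕ
  N = 2 * n
  T : ℕ → ℕ → Set
  T = Tunneling N (extend D)
  open PerfectMatching (tunneling-perfect (Equivalence.to (IsDyck⇔IsDyckℕ {w = extend D} (extend-Extends D)) dyck))
  M : ℕ → ℕ → Set
  M x y = x < N × y < N × T (φ x) (φ y)
  M∘γ : ∀ {a b} → M (toℕ (γ a)) (toℕ (γ b)) ⇔ T (toℕ a) (toℕ b)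
  M∘γ {a} {b} = mk⇔ (λ (_ , _ , t) → subst₂ T (φ∘γ a) (φ∘γ b) t)
                    (λ t → toℕ<n (γ a) , toℕ<n (γ b) , subst₂ T (sym (φ∘γ a)) (sym (φ∘γ b)) t)
  total′ : ∀ {x} → x < N → ∃ (M x)
  total′ {x} x< with y , t ← total (φ-bound x<) = let y< = bounded (symmetric t) in
    toℕ (γ (fromℕ< y<)) , x< , toℕ<n _ , subst (T (φ x)) (sym (trans (φ∘γ _) (toℕ-fromℕ< y<))) t
  M-perfect : PerfectMatching N M
  M-perfect = record
    { symmetric   = λ (x< , y< , t) → y< , x< , symmetric t
    ; bounded     = proj₁
    ; total       = total′
    ; functional  = λ (x< , y< , t) (_ , z< , t′) → φ-injective y< z< (functional t t′)
    ; irreflexive = λ (_ , _ , t) → irreflexive t }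
  pulled-back : ∃ λ w → IsDyckℕ n w × (∀ {a b} → Tunneling N w a b ⇔ M a b)
  pulled-back = noncrossing⇒tunneling n M-perfect (preserves symmetric tunneling-noncrossing)
  w : Wordℕ
  w = proj₁ pulled-back
  dyck′ : IsDyckℕ n w
  dyck′ = proj₁ (proj₂ pulled-back)
  tunneling′ : ∀ {a b} → Tunneling N w a b ⇔ M a b
  tunneling′ = proj₂ (proj₂ pulled-back)

module Circle (K : ℕ) where
  N : ℕ
  N = suc K

  next prev mirror : ℕ → ℕ
  next x   = suc x % N
  prev x   = (x + (N ∸ 1)) % N
  mirror x = ((2 * N ∸ 2) ∸ x) % N

  next-< : ∀ {x} → x < K → next x ≡ suc x
  next-< x<K = m<n⇒m%n≡m (s≤s x<K)

  next-K : next K ≡ 0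
  next-K = n%n≡0 N

  prev-0 : prev 0 ≡ K
  prev-0 = m<n⇒m%n≡m ≤-refl

  prev-suc : ∀ {y} → suc y < N → prev (suc y) ≡ y
  prev-suc {y} sy<N = begin
    (suc y + K) % N ≡⟨ cong (_% N) (+-suc y K) ⟨
    (y + N) % N     ≡⟨ [m+n]%n≡m%n y N ⟩
    y % N           ≡⟨ m<n⇒m%n≡m (<-trans (n<1+n y) sy<N) ⟩
    y               ∎
    where open ≡-Reasoning

  -- mirror reverses 0 … K - 1 and fixes K.
  mirror-< : ∀ {x} → x < K → suc (mirror x + x) ≡ K
  mirror-< {x} x<K = begin
    suc (mirror x + x) ≡⟨ cong (λ m → suc (m + x)) mirror≡t ⟩
    suc (t + x)        ≡⟨ cong suc (+-comm t x) ⟩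
    suc x + t          ≡⟨ m+[n∸m]≡n x<K ⟩
    K                  ∎
    where
    open ≡-Reasoning
    t : ℕ
    t = K ∸ suc x
    rearrange : ∀ x t → suc x + t + (suc x + t + 0) ≡ x + (t + suc (suc x + t))
    rearrange = solve-∀
    2N∸2∸x : (2 * N ∸ 2) ∸ x ≡ t + N
    2N∸2∸x = begin
      (2 * N ∸ 2) ∸ x                   ≡⟨ cong (λ m → (m ∸ 2) ∸ x) (*-suc 2 K) ⟩
      (K + (K + 0)) ∸ x                 ≡⟨ cong (λ m → (m + (m + 0)) ∸ x) (m+[n∸m]≡n x<K) ⟨
      (suc x + t + (suc x + t + 0)) ∸ x ≡⟨ cong (_∸ x) (rearrange x t) ⟩
      (x + (t + suc (suc x + t))) ∸ x   ≡⟨ m+n∸m≡n x _ ⟩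
      t + suc (suc x + t)               ≡⟨ cong (λ m → t + suc m) (m+[n∸m]≡n x<K) ⟩
      t + N                             ∎
    mirror≡t : mirror x ≡ t
    mirror≡t = trans (cong (_% N) 2N∸2∸x) (trans ([m+n]%n≡m%n t N) (m<n⇒m%n≡m (s≤s (m∸n≤m K (suc x)))))

  mirror-K : mirror K ≡ K
  mirror-K = begin
    ((2 * N ∸ 2) ∸ K) % N   ≡⟨ cong (λ m → ((m ∸ 2) ∸ K) % N) (*-suc 2 K) ⟩
    ((K + (K + 0)) ∸ K) % N ≡⟨ cong (_% N) (m+n∸m≡n K (K + 0)) ⟩
    (K + 0) % N             ≡⟨ m<n⇒m%n≡m (s≤s (≤-reflexive (+-identityʳ K))) ⟩
    K + 0                   ≡⟨ +-identityʳ K ⟩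
    K                       ∎
    where open ≡-Reasoning

  next<N : ∀ x → next x < N
  next<N x = m%n<n (suc x) N

  prev<N : ∀ x → prev x < N
  prev<N x = m%n<n (x + K) N

  mirror<N : ∀ x → mirror x < N
  mirror<N x = m%n<n ((2 * N ∸ 2) ∸ x) N

  mirror-<K : ∀ {x} → x < K → mirror x < K
  mirror-<K {x} x<K = subst (mirror x <_) (mirror-< x<K) (s≤s (m≤m+n (mirror x) x))

  mirror-anti : ∀ {x y} → x < y → y < K → mirror y < mirror x
  mirror-anti {x} {y} x<y y<K with mirror y <? mirror x
  ... | yes lt = lt
  ... | no ≮ = ⊥-elim (+-≤-<-≢ (≮⇒≥ ≮) x<y (suc-injective (trans (mirror-< (<-trans x<y y<K)) (sym (mirror-< y<K)))))

  prev∘next : ∀ {x} → x < N → prev (next x) ≡ x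
  prev∘next {x} x<N with m≤n⇒m<n∨m≡n (≤-pred x<N)
  ... | inj₁ x<K  rewrite next-< x<K = prev-suc (s≤s x<K)
  ... | inj₂ refl rewrite next-K     = prev-0

  next∘prev : ∀ {x} → x < N → next (prev x) ≡ x
  next∘prev {zero}  _    rewrite prev-0        = next-K
  next∘prev {suc y} y<N rewrite prev-suc y<N   = next-< (≤-pred y<N)

  mirror∘mirror : ∀ {x} → x < N → mirror (mirror x) ≡ x
  mirror∘mirror {x} x<N with m≤n⇒m<n∨m≡n (≤-pred x<N)
  ... | inj₂ refl rewrite mirror-K = mirror-K
  ... | inj₁ x<K = +-cancelʳ-≡ (mirror x) (mirror (mirror x)) x (suc-injective (begin
    suc (mirror (mirror x) + mirror x) ≡⟨ mirror-< (mirror-<K x<K) ⟩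
    K                                  ≡⟨ mirror-< x<K ⟨
    suc (mirror x + x)                 ≡⟨ cong suc (+-comm (mirror x) x) ⟩
    suc (x + mirror x)                 ∎))
    where open ≡-Reasoning

  prev-preserves : PreservesNonCrossing N prev
  prev-preserves {M} sym-M nc {zero} {suc b} {suc c} {suc e} (_ , b< , mab) (c< , e< , mce) _ (s≤s c<b) (s≤s b<e)
    rewrite prev-0 | prev-suc b< | prev-suc c< | prev-suc e< = nc mce (sym-M mab) c<b b<e (≤-pred e<)
  prev-preserves {M} sym-M nc {suc a} {suc b} {suc c} {suc e} (a< , b< , mab) (c< , e< , mce) (s≤s a<c) (s≤s c<b) (s≤s b<e)
    rewrite prev-suc a< | prev-suc b< | prev-suc c< | prev-suc e< = nc mab mce a<c c<b b<e

  next-preserves : PreservesNonCrossing N next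
  next-preserves {M} sym-M nc {a} {b} {c} {e} (a< , b< , mab) (c< , e< , mce) a<c c<b b<e with m≤n⇒m<n∨m≡n (≤-pred e<)
  ... | inj₁ e<K rewrite next-< (<-trans a<c (<-trans c<b (<-trans b<e e<K))) | next-< (<-trans b<e e<K)
                       | next-< (<-trans c<b (<-trans b<e e<K)) | next-< e<K
    = nc mab mce (s≤s a<c) (s≤s c<b) (s≤s b<e)
  ... | inj₂ refl rewrite next-< (<-trans a<c (<-trans c<b b<e)) | next-< b<e | next-< (<-trans c<b b<e) | next-K
    = nc (sym-M mce) mab z<s (s≤s a<c) (s≤s c<b)

  mirror-preserves : PreservesNonCrossing N mirror
  mirror-preserves {M} sym-M nc {a} {b} {c} {e} (a< , b< , mab) (c< , e< , mce) a<c c<b b<e with m≤n⇒m<n∨m≡n (≤-pred e<)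
  ... | inj₁ e<K = nc (sym-M mce) (sym-M mab) (mirror-anti b<e e<K) (mirror-anti c<b (<-trans b<e e<K))
                      (mirror-anti a<c (<-trans c<b (<-trans b<e e<K)))
  ... | inj₂ refl rewrite mirror-K = nc (sym-M mab) mce (mirror-anti c<b b<e) (mirror-anti a<c (<-trans c<b b<e))
                                        (mirror-<K (<-trans a<c (<-trans c<b b<e)))

  next∘mirror∘next : ∀ {x} → x < N → next (mirror (next x)) ≡ mirror x
  next∘mirror∘next {x} x<N with m≤n⇒m<n∨m≡n (≤-pred x<N)
  ... | inj₂ refl rewrite next-K | mirror-K with m≤n⇒m<n∨m≡n (z≤n {K})
  ...   | inj₂ 0≡K = trans (n<1⇒n≡0 (subst (λ k → next (mirror 0) < suc k) (sym 0≡K) (next<N (mirror 0)))) 0≡K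
  ...   | inj₁ 0<K = trans (next-< (mirror-<K 0<K)) (trans (cong suc (sym (+-identityʳ (mirror 0)))) (mirror-< 0<K))
  next∘mirror∘next {x} x<N | inj₁ x<K with m≤n⇒m<n∨m≡n x<K
  ... | inj₁ sx<K rewrite next-< x<K | next-< (mirror-<K sx<K) = +-cancelʳ-≡ x _ _ (suc-injective (begin
    suc (suc (mirror (suc x)) + x) ≡⟨ cong suc (+-suc (mirror (suc x)) x) ⟨
    suc (mirror (suc x) + suc x)   ≡⟨ mirror-< sx<K ⟩
    K                              ≡⟨ mirror-< x<K ⟨
    suc (mirror x + x)             ∎))
    where open ≡-Reasoning
  ... | inj₂ sx≡K rewrite next-< x<K = begin
    next (mirror (suc x)) ≡⟨ cong (λ y → next (mirror y)) sx≡K ⟩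
    next (mirror K)       ≡⟨ cong next mirror-K ⟩
    next K                ≡⟨ next-K ⟩
    0                     ≡⟨ +-cancelʳ-≡ x (mirror x) 0 (suc-injective (trans (mirror-< x<K) (sym sx≡K))) ⟨
    mirror x              ∎
    where open ≡-Reasoning

zigzag : ℕ → Wordℕ
zigzag zero    = λ _ → u
zigzag (suc n) = insertUD 0 (zigzag n)

zigzag-dyck : ∀ n → IsDyckℕ n (zigzag n)
zigzag-dyck zero    = refl , refl , λ { zero _ → z≤n }
zigzag-dyck (suc n) = InsertUD.insertUD-dyck 0 (zigzag n) (zigzag-dyck n) z≤n

-- Insert ud at k - 2 into any Dyck word of size n - 2, then ud at 0.
two-adjacent-chords : ∀ n k → 2 ≤ k → suc k < 2 * n → ∃ λ w → IsDyckℕ n w × Matchℕ w 0 1 × Matchℕ w k (suc k)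
two-adjacent-chords (suc (suc n)) (suc (suc k)) _ k<2n =
  insertUD 0 v ,
  InsertUD.insertUD-dyck 0 v (InsertUD.insertUD-dyck k (zigzag n) (zigzag-dyck n) k≤2n) z≤n ,
  InsertUD.inserted-match 0 v ,
  Equivalence.from (InsertUD.match-skip 0 v) (InsertUD.inserted-match k (zigzag n))
  where
  v : Wordℕ
  v = insertUD k (zigzag n)
  k≤2n : k ≤ 2 * n
  k≤2n = +-cancelˡ-≤ 4 k (2 * n) (subst (4 + k ≤_) (trans (*-suc 2 (suc n)) (cong (2 +_) (*-suc 2 n))) k<2n)
two-adjacent-chords _ zero () _
two-adjacent-chords _ (suc zero) (s≤s ()) _
two-adjacent-chords zero (suc (suc k)) _ ()
two-adjacent-chords (suc zero) (suc (suc k)) _ (s≤s (s≤s ()))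

Between : ℕ → ℕ → ℕ → Set
Between a b x = a < x × x < b

chord-side : ∀ {w a b x y} → Pairedℕ w a b → Pairedℕ w x y → y ≢ a → y ≢ b → Between a b x → Between a b y
chord-side {y = y} pab pxy y≢a y≢b (a<x , x<b) with <-cmp y _
... | tri< y<a _ _ = ⊥-elim (Pairedℕ-noncrossing (Pairedℕ-sym pxy) pab y<a a<x x<b)
... | tri≈ _ y≡a _ = ⊥-elim (y≢a y≡a)
... | tri> _ _ a<y with <-cmp y _
...   | tri< y<b _ _ = a<y , y<b
...   | tri≈ _ y≡b _ = ⊥-elim (y≢b y≡b)
...   | tri> _ _ b<y = ⊥-elim (Pairedℕ-noncrossing pab pxy a<x x<b b<y)

-- If h 2, …, h (N - 1) are the positions other than a and b, and consecutive ones are always joined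
-- by a chord not crossing {a, b}, they all lie on one side of it; so one side is empty.
module OneSide {N a b : ℕ} (a<b : a < b) (b<N : b < N) (h : ℕ → ℕ)
  (avoids : ∀ {k} → 2 ≤ k → k < N → h k ≢ a × h k ≢ b)
  (covers : ∀ {x} → x < N → x ≢ a → x ≢ b → ∃ λ k → 2 ≤ k × k < N × h k ≡ x)
  (chords : ∀ {k} → 2 ≤ k → suc k < N → ∃ λ w → Pairedℕ w a b × Pairedℕ w (h k) (h (suc k)))
  where

  private
    step : ∀ {k} → 2 ≤ k → suc k < N → Between a b (h k) ⇔ Between a b (h (suc k))
    step {k} 2≤k sk<N with w , pab , pk ← chords 2≤k sk<N =
      let sk≢a , sk≢b = avoids (m≤n⇒m≤1+n 2≤k) sk<N
          k≢a  , k≢b  = avoids 2≤k (<-trans (n<1+n k) sk<N)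
      in mk⇔ (chord-side pab pk sk≢a sk≢b) (chord-side pab (Pairedℕ-sym pk) k≢a k≢b)

    same-side : ∀ {k} → 2 ≤ k → k < N → Between a b (h k) ⇔ Between a b (h 2)
    same-side {1} (s≤s ()) _
    same-side {2} _ _ = ⇔.refl
    same-side {suc (suc (suc t))} _ lt =
      ⇔.trans (⇔.sym (step (s≤s (s≤s z≤n)) lt)) (same-side (s≤s (s≤s z≤n)) (<-trans (n<1+n _) lt))

    side-of : ∀ {x} → x < N → x ≢ a → x ≢ b → Between a b x ⇔ Between a b (h 2)
    side-of x<N x≢a x≢b with k , 2≤k , k<N , refl ← covers x<N x≢a x≢b = same-side 2≤k k<N

  adjacent : b ≡ suc a ⊎ (a ≡ 0 × suc b ≡ N)
  adjacent with b ≟ suc a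
  ... | yes b≡sa = inj₁ b≡sa
  ... | no b≢sa = inj₂ (a≡0 , sb≡N)
    where
    sa<b : suc a < b
    sa<b = ≤∧≢⇒< a<b (b≢sa ∘ sym)
    h2-inside : Between a b (h 2)
    h2-inside = Equivalence.to (side-of (<-trans sa<b b<N) (λ eq → <-irrefl (sym eq) (n<1+n a)) (λ eq → <-irrefl eq sa<b))
                  (n<1+n a , sa<b)
    a≡0 : a ≡ 0
    a≡0 with a ≟ 0
    ... | yes a≡0 = a≡0
    ... | no a≢0 = ⊥-elim (n≮0 (proj₁ (Equivalence.from (side-of (<-trans (n≢0⇒n>0 a≢0) (<-trans a<b b<N))
                     (a≢0 ∘ sym) (λ eq → n≮0 (subst (a <_) (sym eq) a<b))) h2-inside)))
    sb≡N : suc b ≡ N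
    sb≡N with suc b ≟ N
    ... | yes sb≡N = sb≡N
    ... | no sb≢N = ⊥-elim (<-asym (n<1+n b) (proj₂ (Equivalence.from (side-of (≤∧≢⇒< b<N sb≢N)
                     (λ eq → <-irrefl (sym eq) (<-trans a<b (n<1+n b))) (λ eq → <-irrefl (sym eq) (n<1+n b))) h2-inside)))

IsPathAfter-∘ : ∀ {n D} {g h : Fin (2 * n) → Fin (2 * n)} → IsPathAfter n D g →
  (∀ P → IsDyck n P → IsPathAfter n P h) → IsPathAfter n D (h ∘ g)
IsPathAfter-∘ {g = g} (P , dyck , pairs) h-paths with Q , dyck′ , pairs′ ← h-paths P dyck =
  Q , dyck′ , λ a b → ⇔.trans (pairs′ (g a) (g b)) (pairs a b)

IsPathAfter-cong : ∀ {n D} {g g′ : Fin (2 * n) → Fin (2 * n)} → (∀ i → g i ≡ g′ i) →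
  IsPathAfter n D g′ → IsPathAfter n D g
IsPathAfter-cong {D = D} g≗g′ (P , dyck , pairs) =
  P , dyck , λ a b → subst₂ (λ x y → Paired P x y ⇔ Paired D a b) (sym (g≗g′ a)) (sym (g≗g′ b)) (pairs a b)

-- K = pred (2 * n), so that the circle size N = suc K is definitionally 2 * n.
module Dihedral (m : ℕ) where
  n : ℕ
  n = suc m
  K : ℕ
  K = pred (2 * n)
  open Circle K public

  injective-on : ∀ (φ ψ : ℕ → ℕ) → (∀ {x} → x < N → ψ (φ x) ≡ x) →
    ∀ {x y} → x < N → y < N → φ x ≡ φ y → x ≡ y
  injective-on φ ψ ψ∘φ {x} {y} x< y< eq = trans (sym (ψ∘φ x<)) (trans (cong ψ eq) (ψ∘φ y<))

  toℕ-rotate : ∀ i → toℕ (rotate N i) ≡ next (toℕ i)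
  toℕ-rotate i = toℕ-fromℕ< (next<N (toℕ i))

  toℕ-rotate⁻¹ : ∀ i → toℕ (rotate⁻¹ N i) ≡ prev (toℕ i)
  toℕ-rotate⁻¹ i = toℕ-fromℕ< (prev<N (toℕ i))

  toℕ-reflect : ∀ i → toℕ (reflect N i) ≡ mirror (toℕ i)
  toℕ-reflect i = toℕ-fromℕ< (mirror<N (toℕ i))

  generator-paths : ∀ x D → IsDyck n D → IsPathAfter n D (evalGen N x)
  generator-paths ρ   = path-after n (rotate N) prev (λ i → trans (cong prev (toℕ-rotate i)) (prev∘next (toℕ<n i)))
                          (λ {x} _ → prev<N x) (injective-on prev next next∘prev) prev-preserves
  generator-paths ρ⁻¹ = path-after n (rotate⁻¹ N) next (λ i → trans (cong next (toℕ-rotate⁻¹ i)) (next∘prev (toℕ<n i)))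
                          (λ {x} _ → next<N x) (injective-on next prev prev∘next) next-preserves
  generator-paths ω   = path-after n (reflect N) mirror (λ i → trans (cong mirror (toℕ-reflect i)) (mirror∘mirror (toℕ<n i)))
                          (λ {x} _ → mirror<N x) (injective-on mirror mirror mirror∘mirror) mirror-preserves
  generator-paths ω⁻¹ = generator-paths ω

  word-paths : ∀ w D → IsDyck n D → IsPathAfter n D (evalWord N w)
  word-paths []       D dyck = D , dyck , λ _ _ → ⇔.refl
  word-paths (x ∷ xs) D dyck = IsPathAfter-∘ (word-paths xs D dyck) (generator-paths x)

  ι : ℕ → Fin N
  ι k = modFin N k

  toℕ-ι : ∀ k → toℕ (ι k) ≡ k % N
  toℕ-ι k = toℕ-fromℕ< (m%n<n k N)

  toℕ-ι-< : ∀ {k} → k < N → toℕ (ι k) ≡ k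
  toℕ-ι-< {k} k<N = trans (toℕ-ι k) (m<n⇒m%n≡m k<N)

  ι-toℕ : ∀ x → ι (toℕ x) ≡ x
  ι-toℕ x = toℕ-injective (toℕ-ι-< (toℕ<n x))

  rotations : ℕ → Fin N → Fin N
  rotations a = evalWord N (replicate a ρ)

  suc-% : ∀ y → suc (y % N) % N ≡ suc y % N
  suc-% y = begin
    (1 + y % N) % N         ≡⟨ %-distribˡ-+ 1 (y % N) N ⟩
    (1 % N + y % N % N) % N ≡⟨ cong (λ z → (1 % N + z) % N) (m%n%n≡m%n y N) ⟩
    (1 % N + y % N) % N     ≡⟨ %-distribˡ-+ 1 y N ⟨
    (1 + y) % N             ∎
    where open ≡-Reasoning

  toℕ-rotations : ∀ a x → toℕ (rotations a x) ≡ (toℕ x + a) % N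
  toℕ-rotations zero    x = sym (trans (cong (_% N) (+-identityʳ (toℕ x))) (m<n⇒m%n≡m (toℕ<n x)))
  toℕ-rotations (suc a) x = begin
    toℕ (rotate N (rotations a x)) ≡⟨ toℕ-rotate (rotations a x) ⟩
    suc (toℕ (rotations a x)) % N  ≡⟨ cong (λ z → suc z % N) (toℕ-rotations a x) ⟩
    suc ((toℕ x + a) % N) % N      ≡⟨ suc-% (toℕ x + a) ⟩
    suc (toℕ x + a) % N            ≡⟨ cong (_% N) (+-suc (toℕ x) a) ⟨
    (toℕ x + suc a) % N            ∎
    where open ≡-Reasoning

  rotations-ι : ∀ a {k} → k < N → rotations a (ι k) ≡ ι (k + a)
  rotations-ι a {k} k<N = toℕ-injective (begin
    toℕ (rotations a (ι k)) ≡⟨ toℕ-rotations a (ι k) ⟩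
    (toℕ (ι k) + a) % N     ≡⟨ cong (λ z → (z + a) % N) (toℕ-ι-< k<N) ⟩
    (k + a) % N             ≡⟨ toℕ-ι (k + a) ⟨
    toℕ (ι (k + a))         ∎)
    where open ≡-Reasoning

  rotations-+ : ∀ a b x → rotations a (rotations b x) ≡ rotations (a + b) x
  rotations-+ zero    b x = refl
  rotations-+ (suc a) b x = cong (rotate N) (rotations-+ a b x)

  rotations-N : ∀ x → rotations N x ≡ x
  rotations-N x = toℕ-injective (trans (toℕ-rotations N x) (trans ([m+n]%n≡m%n (toℕ x) N) (m<n⇒m%n≡m (toℕ<n x))))

  rotations-cancelˡ : ∀ {j} → j ≤ N → ∀ x → rotations (N ∸ j) (rotations j x) ≡ x
  rotations-cancelˡ {j} j≤N x =
    trans (rotations-+ (N ∸ j) j x) (trans (cong (λ a → rotations a x) (m∸n+n≡m j≤N)) (rotations-N x))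

  rotations-cancelʳ : ∀ {j} → j ≤ N → ∀ x → rotations j (rotations (N ∸ j) x) ≡ x
  rotations-cancelʳ {j} j≤N x =
    trans (rotations-+ j (N ∸ j) x) (trans (cong (λ a → rotations a x) (m+[n∸m]≡n j≤N)) (rotations-N x))

  Adjacent : Fin N → Fin N → Set
  Adjacent p q = q ≡ rotate N p ⊎ p ≡ rotate N q

  adjacent-from-ℕ : ∀ {p q} → toℕ q ≡ suc (toℕ p) ⊎ (toℕ p ≡ 0 × suc (toℕ q) ≡ N) → Adjacent p q
  adjacent-from-ℕ {p} {q} (inj₁ q≡sp) = inj₁ (toℕ-injective (begin
    toℕ q            ≡⟨ q≡sp ⟩
    suc (toℕ p)      ≡⟨ next-< (≤-pred (subst (_< N) q≡sp (toℕ<n q))) ⟨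
    next (toℕ p)     ≡⟨ toℕ-rotate p ⟨
    toℕ (rotate N p) ∎))
    where open ≡-Reasoning
  adjacent-from-ℕ {p} {q} (inj₂ (p≡0 , sq≡N)) = inj₂ (toℕ-injective (begin
    toℕ p            ≡⟨ p≡0 ⟩
    0                ≡⟨ next-K ⟨
    next K           ≡⟨ cong next (suc-injective sq≡N) ⟨
    next (toℕ q)     ≡⟨ toℕ-rotate q ⟨
    toℕ (rotate N q) ∎))
    where open ≡-Reasoning

  Adjacent-sym : ∀ {p q} → Adjacent p q → Adjacent q p
  Adjacent-sym (inj₁ eq) = inj₂ eq
  Adjacent-sym (inj₂ eq) = inj₁ eq

  1<N : 1 < N
  1<N = s≤s (subst (0 <_) (sym (+-suc m (m + 0))) z<s)

  module FirstStep (G G⁻¹ : Fin N → Fin N) (G⁻¹∘G : ∀ a → G⁻¹ (G a) ≡ a) (G∘G⁻¹ : ∀ c → G (G⁻¹ c) ≡ c)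
                   (paths : ∀ D → IsDyck n D → IsPathAfter n D G) where
    h : ℕ → ℕ
    h k = toℕ (G (ι k))

    h-injective : ∀ {k l} → k < N → l < N → h k ≡ h l → k ≡ l
    h-injective {k} {l} k< l< eq = trans (sym (toℕ-ι-< k<)) (trans (cong toℕ ιk≡ιl) (toℕ-ι-< l<))
      where
      ιk≡ιl : ι k ≡ ι l
      ιk≡ιl = trans (sym (G⁻¹∘G (ι k))) (trans (cong G⁻¹ (toℕ-injective eq)) (G⁻¹∘G (ι l)))

    avoids : ∀ {k} → 2 ≤ k → k < N → h k ≢ h 0 × h k ≢ h 1
    avoids (s≤s (s≤s _)) k< = (λ eq → 1+n≢0 (h-injective k< z<s eq)) , (λ eq → 1+n≢0 (suc-injective (h-injective k< 1<N eq)))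

    covers : ∀ {x} → x < N → x ≢ h 0 → x ≢ h 1 → ∃ λ k → 2 ≤ k × k < N × h k ≡ x
    covers {x} x< x≢h0 x≢h1 = k , 2≤k k hk≡x , toℕ<n _ , hk≡x
      where
      k : ℕ
      k = toℕ (G⁻¹ (ι x))
      hk≡x : h k ≡ x
      hk≡x = begin
        toℕ (G (ι (toℕ (G⁻¹ (ι x))))) ≡⟨ cong (toℕ ∘ G) (ι-toℕ (G⁻¹ (ι x))) ⟩
        toℕ (G (G⁻¹ (ι x)))           ≡⟨ cong toℕ (G∘G⁻¹ (ι x)) ⟩
        toℕ (ι x)                     ≡⟨ toℕ-ι-< x< ⟩
        x                             ∎
        where open ≡-Reasoning
      2≤k : ∀ k → h k ≡ x → 2 ≤ k
      2≤k 0 hk≡x = ⊥-elim (x≢h0 (sym hk≡x))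
      2≤k 1 hk≡x = ⊥-elim (x≢h1 (sym hk≡x))
      2≤k (suc (suc _)) _ = s≤s (s≤s z≤n)

    private
      transport : ∀ {w Q} → (∀ a b → Paired Q (G a) (G b) ⇔ Paired (w ∘ toℕ) a b) →
        ∀ {i j} → i < N → j < N → Matchℕ w i j → Pairedℕ (extend Q) (h i) (h j)
      transport {w} {Q} pairs {i} {j} i< j< mij = Equivalence.to (Paired⇔Pairedℕ (extend-Extends Q))
        (Equivalence.from (pairs (ι i) (ι j)) (Equivalence.from (Paired⇔Pairedℕ (λ _ → refl))
          (subst₂ (Pairedℕ w) (sym (toℕ-ι-< i<)) (sym (toℕ-ι-< j<)) (inj₁ mij))))

    chords : ∀ {k} → 2 ≤ k → suc k < N → ∃ λ w → Pairedℕ w (h 0) (h 1) × Pairedℕ w (h k) (h (suc k))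
    chords {k} 2≤k sk<N with w , dyck , m01 , mk ← two-adjacent-chords n k 2≤k sk<N
      with Q , _ , pairs ← paths (w ∘ toℕ) (Equivalence.from (IsDyck⇔IsDyckℕ {n} (λ _ → refl)) dyck)
      = extend Q , transport pairs z<s 1<N m01 , transport pairs (<-trans (n<1+n k) sk<N) sk<N mk

    first-adjacent : Adjacent (G (ι 0)) (G (ι 1))
    first-adjacent with <-cmp (h 0) (h 1)
    ... | tri< lt _ _ = adjacent-from-ℕ (OneSide.adjacent lt (toℕ<n _) h avoids covers chords)
    ... | tri> _ _ gt = Adjacent-sym (adjacent-from-ℕ (OneSide.adjacent gt (toℕ<n _) h
          (λ 2≤k k< → let ne₀ , ne₁ = avoids 2≤k k< in ne₁ , ne₀)
          (λ x< x≢h1 x≢h0 → covers x< x≢h0 x≢h1)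
          (λ 2≤k sk< → let w , p01 , pk = chords 2≤k sk< in w , Pairedℕ-sym p01 , pk)))
    ... | tri≈ _ eq _ = ⊥-elim (1+n≢0 (sym (h-injective z<s 1<N eq)))

  -- Precomposing with ρ^j, which maps paths to paths, moves the pair (j, j + 1) to (0, 1).
  adjacent-consecutive : (G G⁻¹ : Fin N → Fin N) → (∀ a → G⁻¹ (G a) ≡ a) → (∀ c → G (G⁻¹ c) ≡ c) →
    (∀ D → IsDyck n D → IsPathAfter n D G) → ∀ j → suc j < N → Adjacent (G (ι j)) (G (ι (suc j)))
  adjacent-consecutive G G⁻¹ G⁻¹∘G G∘G⁻¹ paths j sj<N =
    subst₂ Adjacent (cong G (rotations-ι j z<s)) (cong G (rotations-ι j 1<N))
      (FirstStep.first-adjacent (G ∘ rotations j) (rotations (N ∸ j) ∘ G⁻¹)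
        (λ a → trans (cong (rotations (N ∸ j)) (G⁻¹∘G _)) (rotations-cancelˡ j≤N a))
        (λ c → trans (cong G (rotations-cancelʳ j≤N (G⁻¹ c))) (G∘G⁻¹ c))
        (λ D dyck → IsPathAfter-∘ (word-paths (replicate j ρ) D dyck) paths))
    where
    j≤N : j ≤ N
    j≤N = <⇒≤ (<-trans (n<1+n j) sj<N)

  rotate-injective : ∀ {p q} → rotate N p ≡ rotate N q → p ≡ q
  rotate-injective {p} {q} eq = toℕ-injective (begin
    toℕ p                   ≡⟨ prev∘next (toℕ<n p) ⟨
    prev (next (toℕ p))     ≡⟨ cong prev (trans (sym (toℕ-rotate p)) (trans (cong toℕ eq) (toℕ-rotate q))) ⟩
    prev (next (toℕ q))     ≡⟨ prev∘next (toℕ<n q) ⟩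
    toℕ q                   ∎)
    where open ≡-Reasoning

  reflect-involutive : ∀ p → reflect N (reflect N p) ≡ p
  reflect-involutive p = toℕ-injective (trans (toℕ-reflect (reflect N p))
    (trans (cong mirror (toℕ-reflect p)) (mirror∘mirror (toℕ<n p))))

  rotate∘reflect∘rotate : ∀ p → rotate N (reflect N (rotate N p)) ≡ reflect N p
  rotate∘reflect∘rotate p = toℕ-injective (begin
    toℕ (rotate N (reflect N (rotate N p))) ≡⟨ toℕ-rotate (reflect N (rotate N p)) ⟩
    next (toℕ (reflect N (rotate N p)))     ≡⟨ cong next (toℕ-reflect (rotate N p)) ⟩
    next (mirror (toℕ (rotate N p)))        ≡⟨ cong (next ∘ mirror) (toℕ-rotate p) ⟩
    next (mirror (next (toℕ p)))            ≡⟨ next∘mirror∘next (toℕ<n p) ⟩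
    mirror (toℕ p)                          ≡⟨ toℕ-reflect p ⟨
    toℕ (reflect N p)                       ∎)
    where open ≡-Reasoning

  Adjacent-reflect : ∀ {p q} → Adjacent p q → Adjacent (reflect N p) (reflect N q)
  Adjacent-reflect {p} (inj₁ refl) = inj₂ (sym (rotate∘reflect∘rotate p))
  Adjacent-reflect {q = q} (inj₂ refl) = inj₁ (sym (rotate∘reflect∘rotate q))

  module _ (F : Fin N → Fin N) (F-injective : ∀ {p q} → F p ≡ F q → p ≡ q)
           (consecutive : ∀ j → suc j < N → Adjacent (F (ι j)) (F (ι (suc j)))) where

    private
      forwards : F (ι 1) ≡ rotate N (F (ι 0)) → ∀ j → suc j < N → F (ι (suc j)) ≡ rotate N (F (ι j))
      forwards start zero    _ = start
      forwards start (suc j) sj<N with consecutive (suc j) sj<N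
      ... | inj₁ eq = eq
      ... | inj₂ eq = ⊥-elim (<-irrefl (sym 2+j≡j) (<-trans (n<1+n j) (n<1+n (suc j))))
        where
        ι-eq : ι (suc (suc j)) ≡ ι j
        ι-eq = F-injective (rotate-injective (trans (sym eq) (forwards start j (<-trans (n<1+n (suc j)) sj<N))))
        2+j≡j : 2 + j ≡ j
        2+j≡j = trans (sym (toℕ-ι-< sj<N)) (trans (cong toℕ ι-eq) (toℕ-ι-< (<-trans (n<1+n j) (<-trans (n<1+n (suc j)) sj<N))))

      orbit : F (ι 1) ≡ rotate N (F (ι 0)) → ∀ j → j < N → F (ι j) ≡ rotations j (F (ι 0))
      orbit start zero    _   = refl
      orbit start (suc j) sj< = trans (forwards start j sj<) (cong (rotate N) (orbit start j (<-trans (n<1+n j) sj<)))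

    rotation-if-forwards : F (ι 1) ≡ rotate N (F (ι 0)) → ∀ x → F x ≡ rotations (toℕ (F (ι 0))) x
    rotation-if-forwards start x = toℕ-injective (begin
      toℕ (F x)                                 ≡⟨ cong (toℕ ∘ F) (ι-toℕ x) ⟨
      toℕ (F (ι (toℕ x)))                       ≡⟨ cong toℕ (orbit start (toℕ x) (toℕ<n x)) ⟩
      toℕ (rotations (toℕ x) (F (ι 0)))         ≡⟨ toℕ-rotations (toℕ x) (F (ι 0)) ⟩
      (toℕ (F (ι 0)) + toℕ x) % N               ≡⟨ cong (_% N) (+-comm (toℕ (F (ι 0))) (toℕ x)) ⟩
      (toℕ x + toℕ (F (ι 0))) % N               ≡⟨ toℕ-rotations (toℕ (F (ι 0))) x ⟨
      toℕ (rotations (toℕ (F (ι 0))) x)         ∎)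
      where open ≡-Reasoning

  -- If F turns backwards at 0, then ω ∘ F turns forwards.
  dihedral-if-consecutive-adjacent : (F : Fin N → Fin N) → (∀ {p q} → F p ≡ F q → p ≡ q) →
    (∀ j → suc j < N → Adjacent (F (ι j)) (F (ι (suc j)))) → ∃ λ w → ∀ i → F i ≡ evalWord N w i
  dihedral-if-consecutive-adjacent F F-injective consecutive with consecutive 0 1<N
  ... | inj₁ start = replicate (toℕ (F (ι 0))) ρ , rotation-if-forwards F F-injective consecutive start
  ... | inj₂ start = ω ∷ replicate (toℕ (F′ (ι 0))) ρ , λ i →
          trans (sym (reflect-involutive (F i))) (cong (reflect N) (rotation-if-forwards F′ F′-injective consecutive′ start′ i))
    where
    F′ : Fin N → Fin N
    F′ = reflect N ∘ F
    F′-injective : ∀ {p q} → F′ p ≡ F′ q → p ≡ q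
    F′-injective eq = F-injective (trans (sym (reflect-involutive _)) (trans (cong (reflect N) eq) (reflect-involutive _)))
    consecutive′ : ∀ j → suc j < N → Adjacent (F′ (ι j)) (F′ (ι (suc j)))
    consecutive′ j sj<N = Adjacent-reflect (consecutive j sj<N)
    start′ : F′ (ι 1) ≡ rotate N (F′ (ι 0))
    start′ = trans (sym (rotate∘reflect∘rotate (F (ι 1)))) (cong (rotate N ∘ reflect N) (sym start))

theorem7 : (n : ℕ) → (h : 1 ≤ n) → (g : Permutation′ (2 * n)) →
    ((∀ (D : Word (2 * n)) → IsDyck n D → IsPathAfter n D (g ⟨$⟩ʳ_)) ⇔ InDihedral n h g)
theorem7 zero () _
theorem7 (suc m) _ g = mk⇔
  (λ paths → dihedral-if-consecutive-adjacent (g ⟨$⟩ʳ_) injective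
               (adjacent-consecutive (g ⟨$⟩ʳ_) (g ⟨$⟩ˡ_) (λ _ → inverseˡ g) (λ _ → inverseʳ g) paths))
  (λ (w , g≗w) D dyck → IsPathAfter-cong g≗w (word-paths w D dyck))
  where
  open Dihedral m
  injective : ∀ {p q} → g ⟨$⟩ʳ p ≡ g ⟨$⟩ʳ q → p ≡ q
  injective eq = trans (sym (inverseˡ g)) (trans (cong (g ⟨$⟩ˡ_) eq) (inverseˡ g))
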